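{- Let $p$ be a prime, let $l,k,i,j$ be integers with $0\le j\le l$ and $0\le i\le k$, put $A=\mathrm{diag}[p^l,p^{l+k}]$, $\mathbf a=(p^j,p^{i+j})^T$, and $\widehat\alpha=(A,\mathbf a)\in\Delta_{\mathcal H_p}\subset\widehat\Delta_{\mathcal H}$. Then: (1) for every $(B,\mathbf b)\in\eta_{\mathcal H}^{ -1}(\widehat\Gamma_{\mathcal H}\widehat\alpha\widehat\Gamma_{\mathcal H})$ we have $B\in GL_2(\mathbb Z)\,A\,GL_2(\mathbb Z)$; (2) for $\mathbf b\in\mathbb Z^2$, $(A,\mathbf b)\in\eta_{\mathcal H}^{ -1}(\widehat\Gamma_{\mathcal H}\widehat\alpha\widehat\Gamma_{\mathcal H})$ if and only if $\mathbf b\equiv X\mathbf a\bmod A\mathbb Z_p^2$ for some $X\in\Gamma_0(p^k)$; (3) for $\mathbf b,\mathbf c\in\mathbb Z^2$, $\Gamma_{\mathcal H}(A,\mathbf b)\Gamma_{\mathcal H}=\Gamma_{\mathcal H}(A,\mathbf c)\Gamma_{\mathcal H}$ if and only if $\mathbf b\equiv X\mathbf c\bmod A\mathbb Z^2$ for some $X\in\Gamma_0(p^k)\cap GL_2(\mathbb Z)$.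
   Context: $\Gamma_0(p^k)$ is the subgroup of $GL_2(\mathbb Z_p)$ of matrices whose $(2,1)$ entry is divisible by $p^k$; $A\mathbb Z^2=\{A\mathbf v:\mathbf v\in\mathbb Z^2\}$ and $A\mathbb Z_p^2$ similarly. The Heisenberg Lie algebra $\mathcal H$ is the quotient of the free Lie algebra over $\mathbb Z$ on two generators by $[L_2,[L_2,L_2]]$. $\Delta_{\mathcal H}=\mathrm{End}^{alg}_{\mathbb Z}(\mathcal H)\cap\mathrm{Aut}^{alg}_{\mathbb Q}(\mathcal H\otimes\mathbb Q)$ and $\Gamma_{\mathcal H}=\mathrm{Aut}^{alg}_{\mathbb Z}(\mathcal H)$ are identified with $(M_2(\mathbb Z)\cap GL_2(\mathbb Q))\times\mathbb Z^2$ and $GL_2(\mathbb Z)\times\mathbb Z^2$ in the group $GL_2(\mathbb Q)\times\mathbb Q^2$ with product $(A,\mathbf a)(B,\mathbf b)=(AB,A\mathbf b+\det(B)\mathbf a)$; for each prime $q$, $\Delta_{\mathcal H_q}=(M_2(\mathbb Z_q)\cap GL_2(\mathbb Q_q))\times\mathbb Z_q^2$, $\Gamma_{\mathcal H_q}=GL_2(\mathbb Z_q)\times\mathbb Z_q^2$ with the same product. $\widehat\Gamma_{\mathcal H}=\prod_q\Gamma_{\mathcal H_q}$; $\widehat\Delta_{\mathcal H}$ is the set of $(\alpha_q)\in\prod_q\Delta_{\mathcal H_q}$ with $\alpha_q\in\Gamma_{\mathcal H_q}$ for almost all $q$; $\Delta_{\mathcal H_p}\subset\widehat\Delta_{\mathcal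 H}$ by putting the identity in the components $q\ne p$. $\eta_{\mathcal H}:\Delta_{\mathcal H}\to\widehat\Delta_{\mathcal H}$ is the diagonal embedding. -}

module Defs where

open import Data.Nat using (ℕ; suc; _^_; _+_)
open import Data.Nat.Primality using (Prime)
open import Data.Integer using (ℤ; +_; _*_; _-_; 0ℤ; 1ℤ) renaming (_+_ to _+ℤ_)
open import Data.Integer.Divisibility using (_∣_)
open import Data.Product using (Σ; ∃; _×_; _,_)
open import Relation.Binary.PropositionalEquality using (_≡_; _≢_)
open import Function.Bundles using (_⇔_)

record M2 : Set where
  constructor mat
  field e11 e12 e21 e22 : ℤ
open M2 public

record V2 : Set where
  constructor vec
  field c1 c2 : ℤ
open V2 public

det : M2 → ℤ
det (mat a b c d) = a * d - b * c

I2 : M2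
I2 = mat 1ℤ 0ℤ 0ℤ 1ℤ

0v : V2
0v = vec 0ℤ 0ℤ

infixl 7 _·_
_·_ : M2 → M2 → M2
mat a b c d · mat a' b' c' d' =
  mat (a * a' +ℤ b * c') (a * b' +ℤ b * d') (c * a' +ℤ d * c') (c * b' +ℤ d * d')

infixl 7 _⊙_
_⊙_ : M2 → V2 → V2
mat a b c d ⊙ vec x y = vec (a * x +ℤ b * y) (c * x +ℤ d * y)

infixl 6 _+v_
_+v_ : V2 → V2 → V2
vec x y +v vec x' y' = vec (x +ℤ x') (y +ℤ y')

_*v_ : ℤ → V2 → V2
s *v vec x y = vec (s * x) (s * y)

HZ : Set
HZ = M2 × V2

infixl 7 _∘H_
_∘H_ : HZ → HZ → HZ
(A , a) ∘H (B , b) = (A · B , (A ⊙ b) +v (det B *v a))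

_≡[_]_ : ℤ → ℤ → ℤ → Set
x ≡[ m ] y = m ∣ (x - y)

_≡M[_]_ : M2 → ℤ → M2 → Set
A ≡M[ m ] B = (e11 A ≡[ m ] e11 B) × (e12 A ≡[ m ] e12 B)
            × (e21 A ≡[ m ] e21 B) × (e22 A ≡[ m ] e22 B)

_≡V[_]_ : V2 → ℤ → V2 → Set
u ≡V[ m ] v = (c1 u ≡[ m ] c1 v) × (c2 u ≡[ m ] c2 v)

_≡H[_]_ : HZ → ℤ → HZ → Set
(A , a) ≡H[ m ] (B , b) = (A ≡M[ m ] B) × (a ≡V[ m ] b)

GL2ℤ : M2 → Set
GL2ℤ U = Σ M2 λ V → (U · V ≡ I2) × (V · U ≡ I2)

InΔH : HZ → Set
InΔH (B , b) = det B ≢ 0ℤ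

InΓH : HZ → Set
InΓH (U , u) = GL2ℤ U

InDCℤ : HZ → HZ → Set
InDCℤ β x = Σ HZ λ γ₁ → Σ HZ λ γ₂ →
  InΓH γ₁ × InΓH γ₂ × (x ≡ γ₁ ∘H β ∘H γ₂)

-- q-adic integers ℤ_q as coherent sequences (inverse limit of ℤ/q^n):
-- seq n is a representative of the image in ℤ/q^n.

pw : ℕ → ℕ → ℤ
pw q n = + (q ^ n)

record Zq (q : ℕ) : Set where
  field
    seq : ℕ → ℤ
    coh : ∀ n → seq (suc n) ≡[ pw q n ] seq n
open Zq public

record M2q (q : ℕ) : Set where
  field f11 f12 f21 f22 : Zq q
open M2q public

record V2q (q : ℕ) : Set where
  field g1 g2 : Zq q
open V2q public

infixl 9 _atM_ _atV_ _atH_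
infix 4 _≡[_]_ _≡M[_]_ _≡V[_]_ _≡H[_]_

_atM_ : ∀ {q} → M2q q → ℕ → M2
X atM n = mat (seq (f11 X) n) (seq (f12 X) n) (seq (f21 X) n) (seq (f22 X) n)

_atV_ : ∀ {q} → V2q q → ℕ → V2
v atV n = vec (seq (g1 v) n) (seq (g2 v) n)

HZq : ℕ → Set
HZq q = M2q q × V2q q

_atH_ : ∀ {q} → HZq q → ℕ → HZ
(X , x) atH n = (X atM n , x atV n)

GL2q : (q : ℕ) → M2q q → Set
GL2q q X = Σ (M2q q) λ Y → ∀ n →
  ((X atM n) · (Y atM n) ≡M[ pw q n ] I2) × ((Y atM n) · (X atM n) ≡M[ pw q n ] I2)

InΓHq : (q : ℕ) → HZq q → Set
InΓHq q (X , x) = GL2q q X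

Γ0 : (p k : ℕ) → M2q p → Set
Γ0 p k X = GL2q p X × Σ (Zq p) λ y → ∀ n → seq (f21 X) n ≡[ pw p n ] (pw p k * seq y n)

InDCq : (q : ℕ) → HZ → HZ → Set
InDCq q β x = Σ (HZq q) λ γ₁ → Σ (HZq q) λ γ₂ →
  InΓHq q γ₁ × InΓHq q γ₂ × (∀ n → x ≡H[ pw q n ] ((γ₁ atH n) ∘H β ∘H (γ₂ atH n)))

Amat : (p l k : ℕ) → M2
Amat p l k = mat (+ (p ^ l)) 0ℤ 0ℤ (+ (p ^ (l + k)))

avec : (p i j : ℕ) → V2
avec p i j = vec (+ (p ^ j)) (+ (p ^ (i + j)))

-- η_H(x) ∈ Γ̂_H α̂ Γ̂_H, where α̂ = (A,a) at p and the identity at q ≠ p;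
-- written componentwise over all primes q.
InAdelicDC : (p : ℕ) → HZ → HZ → Set
InAdelicDC p α x =
  InDCq p α x × (∀ q → Prime q → q ≢ p → InDCq q (I2 , 0v) x)

{-# OPTIONS --safe #-}
-- A p-adic matrix is a coherent sequence of integer matrices, one modulo each p^n, so every
-- step is an integer computation modulo m, for m = p^n in the p-adic parts and m = 0 in part (3).
-- Write A = diag(P, PQ), P = p^l, Q = p^k. If (A, b) = (U, u)(A, c)(V, v), then U A ≡ A V⁻¹
-- makes P U₂₁ a multiple of PQ, and b = X c + A w with X = det V · U ∈ Γ₀(Q). Conversely, for
-- X ∈ Γ₀(Q) with inverse Y, the matrix diag(1,Q)⁻¹ Y diag(1,Q) is integral, and
-- U = det Y · X, V = det X · diag(1,Q)⁻¹ Y diag(1,Q) give (A, X c + A w) = (U, 0)(A, c)(V, V w).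
-- At primes q ≠ p the matrix A is a unit. For (1), the p-component forces B = P T with
-- det T = p^k s, p ∤ s, and an entry of T prime to p, the other components force s = ±1,
-- and a Bézout computation puts T in GL₂(ℤ) diag(1, Q) GL₂(ℤ).
module Submission where

open import Defs

open import Data.Nat as ℕ using (ℕ; zero; suc; _^_; _≤_)
import Data.Nat.Properties as ℕ
import Data.Nat.Divisibility as ℕ
open import Data.Nat.Coprimality using (Coprime; coprime-Bézout)
open import Data.Nat.GCD using (module Bézout)
open import Data.Nat.Primality using (Prime; prime⇒nonZero; euclidsLemma; prime⇒irreducible; ¬prime[1])
open import Data.Nat.Primality.Factorisation using (factorise)
open import Data.Nat.ListAction using (product)
open import Data.Integer as ℤ using (ℤ; +_; -[1+_]; _+_; _*_; _-_; -_; 0ℤ; 1ℤ; -1ℤ; ∣_∣)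
import Data.Integer.Properties as ℤ
open import Data.Integer.Divisibility using (_∣_)
import Data.Integer.Divisibility.Signed as Signed
open import Data.Integer.Tactic.RingSolver using (solve-∀)
open import Data.List using ([]; _∷_)
open import Data.List.Relation.Unary.All using (_∷_)
open import Data.Product using (Σ; _×_; _,_; proj₁; proj₂)
open import Data.Sum using (_⊎_; inj₁; inj₂)
open import Data.Empty using (⊥; ⊥-elim)
open import Relation.Nullary using (¬_; yes; no)
open import Relation.Binary.Bundles using (Setoid)
import Relation.Binary.Reasoning.Setoid
open import Relation.Binary.PropositionalEquality
open import Function.Base using (_∘_)
open import Function.Bundles using (_⇔_; mk⇔; Equivalence)

-- Congruence in the witnessed form x = y + t m, so that its algebra is ring normalisation.
infix 4 _≈[_]_
record _≈[_]_ (x m y : ℤ) : Set where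
  constructor ≈-by
  field
    quot : ℤ
    eqn  : x ≡ y + quot * m

≡[]⇒≈ : ∀ {x y m} → x ≡[ m ] y → x ≈[ m ] y
≡[]⇒≈ {x} {y} {m} h with Signed.∣ᵤ⇒∣ {m} {x - y} h
... | Signed.divides t e = ≈-by t (trans (lemma x y) (cong (λ r → y + r) e))
  where
  lemma : ∀ x y → x ≡ y + (x - y)
  lemma = solve-∀

≈⇒≡[] : ∀ {x y m} → x ≈[ m ] y → x ≡[ m ] y
≈⇒≡[] {x} {y} {m} (≈-by t e) = Signed.∣⇒∣ᵤ {m} {x - y} (Signed.divides t (trans (cong (_- y) e) (lemma y t m)))
  where
  lemma : ∀ y t m → (y + t * m) - y ≡ t * m
  lemma = solve-∀

module _ {m : ℤ} where

  ≈-refl : ∀ {x} → x ≈[ m ] x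
  ≈-refl {x} = ≈-by 0ℤ (lemma x m)
    where
    lemma : ∀ x m → x ≡ x + 0ℤ * m
    lemma = solve-∀

  ≈-reflexive : ∀ {x y} → x ≡ y → x ≈[ m ] y
  ≈-reflexive refl = ≈-refl

  ≈-sym : ∀ {x y} → x ≈[ m ] y → y ≈[ m ] x
  ≈-sym {y = y} (≈-by t refl) = ≈-by (- t) (lemma y t m)
    where
    lemma : ∀ y t m → y ≡ (y + t * m) + (- t) * m
    lemma = solve-∀

  ≈-trans : ∀ {x y z} → x ≈[ m ] y → y ≈[ m ] z → x ≈[ m ] z
  ≈-trans {z = z} (≈-by s refl) (≈-by t refl) = ≈-by (s + t) (lemma z s t m)
    where
    lemma : ∀ z s t m → (z + t * m) + s * m ≡ z + (s + t) * m
    lemma = solve-∀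

  +-cong : ∀ {x y u v} → x ≈[ m ] y → u ≈[ m ] v → x + u ≈[ m ] y + v
  +-cong {y = y} {v = v} (≈-by s refl) (≈-by t refl) = ≈-by (s + t) (lemma y v s t m)
    where
    lemma : ∀ y v s t m → (y + s * m) + (v + t * m) ≡ (y + v) + (s + t) * m
    lemma = solve-∀

  *-cong : ∀ {x y u v} → x ≈[ m ] y → u ≈[ m ] v → x * u ≈[ m ] y * v
  *-cong {y = y} {v = v} (≈-by s refl) (≈-by t refl) = ≈-by (s * v + y * t + s * t * m) (lemma y v s t m)
    where
    lemma : ∀ y v s t m → (y + s * m) * (v + t * m) ≡ y * v + (s * v + y * t + s * t * m) * m
    lemma = solve-∀

  sub-cong : ∀ {x y u v} → x ≈[ m ] y → u ≈[ m ] v → x - u ≈[ m ] y - v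
  sub-cong {y = y} {v = v} (≈-by s refl) (≈-by t refl) = ≈-by (s - t) (lemma y v s t m)
    where
    lemma : ∀ y v s t m → (y + s * m) - (v + t * m) ≡ (y - v) + (s - t) * m
    lemma = solve-∀

  -‿cong : ∀ {x y} → x ≈[ m ] y → - x ≈[ m ] - y
  -‿cong {y = y} (≈-by s refl) = ≈-by (- s) (lemma y s m)
    where
    lemma : ∀ y s m → - (y + s * m) ≡ (- y) + (- s) * m
    lemma = solve-∀

  *-congˡ : ∀ {u v} c → u ≈[ m ] v → c * u ≈[ m ] c * v
  *-congˡ c = *-cong (≈-refl {c})

  *-congʳ : ∀ {u v} c → u ≈[ m ] v → u * c ≈[ m ] v * c
  *-congʳ c h = *-cong h ≈-refl

  m*n≈0 : ∀ n → m * n ≈[ m ] 0ℤ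
  m*n≈0 n = ≈-by n (lemma m n)
    where
    lemma : ∀ m n → m * n ≡ 0ℤ + n * m
    lemma = solve-∀

  ≈0⇒∣ : ∀ {x} → x ≈[ m ] 0ℤ → Σ ℤ λ t → x ≡ m * t
  ≈0⇒∣ {x} (≈-by t e) = t , trans e (trans (ℤ.+-identityˡ (t * m)) (ℤ.*-comm t m))

  ≈-setoid : Setoid _ _
  ≈-setoid = record
    { Carrier = ℤ ; _≈_ = λ x y → x ≈[ m ] y
    ; isEquivalence = record { refl = ≈-refl ; sym = ≈-sym ; trans = ≈-trans } }

  module ≈-Reasoning = Relation.Binary.Reasoning.Setoid ≈-setoid

≈-weaken : ∀ {x y m} d e → m ≡ e * d → x ≈[ m ] y → x ≈[ d ] y
≈-weaken {y = y} d e refl (≈-by s refl) = ≈-by (s * e) (lemma y s e d)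
  where
  lemma : ∀ y s e d → y + s * (e * d) ≡ y + s * e * d
  lemma = solve-∀

≈-cancelˡ : ∀ {x y m} k .{{_ : ℤ.NonZero k}} → k * x ≈[ k * m ] k * y → x ≈[ m ] y
≈-cancelˡ {x} {y} {m} k (≈-by s e) = ≈-by s (ℤ.*-cancelˡ-≡ k x (y + s * m) (trans e (lemma k y s m)))
  where
  lemma : ∀ k y s m → k * y + s * (k * m) ≡ k * (y + s * m)
  lemma = solve-∀

≈[0]⇒≡ : ∀ {x y} → x ≈[ 0ℤ ] y → x ≡ y
≈[0]⇒≡ {x} {y} (≈-by s e) = trans e (lemma y s)
  where
  lemma : ∀ y s → y + s * 0ℤ ≡ y
  lemma = solve-∀

mat-≡ : ∀ {a b c d a' b' c' d'} → a ≡ a' → b ≡ b' → c ≡ c' → d ≡ d' → mat a b c d ≡ mat a' b' c' d'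
mat-≡ refl refl refl refl = refl

vec-≡ : ∀ {a b a' b'} → a ≡ a' → b ≡ b' → vec a b ≡ vec a' b'
vec-≡ refl refl = refl

infixl 7 _*M_
_*M_ : ℤ → M2 → M2
s *M mat a b c d = mat (s * a) (s * b) (s * c) (s * d)

adj : M2 → M2
adj (mat a b c d) = mat d (- b) (- c) a

·-assoc : ∀ X Y Z → (X · Y) · Z ≡ X · (Y · Z)
·-assoc (mat a b c d) (mat e f g h) (mat i j k l) =
  mat-≡ (entry a b e f g h i k) (entry a b e f g h j l) (entry c d e f g h i k) (entry c d e f g h j l)
  where
  entry : ∀ a b e f g h i k → (a * e + b * g) * i + (a * f + b * h) * k ≡ a * (e * i + f * k) + b * (g * i + h * k)
  entry = solve-∀

·-identityˡ : ∀ X → I2 · X ≡ X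
·-identityˡ (mat a b c d) = mat-≡ (top a c) (top b d) (bottom a c) (bottom b d)
  where
  top : ∀ a c → 1ℤ * a + 0ℤ * c ≡ a
  top = solve-∀
  bottom : ∀ a c → 0ℤ * a + 1ℤ * c ≡ c
  bottom = solve-∀

·-identityʳ : ∀ X → X · I2 ≡ X
·-identityʳ (mat a b c d) = mat-≡ (left a b) (right a b) (left c d) (right c d)
  where
  left : ∀ a b → a * 1ℤ + b * 0ℤ ≡ a
  left = solve-∀
  right : ∀ a b → a * 0ℤ + b * 1ℤ ≡ b
  right = solve-∀

det-· : ∀ X Y → det (X · Y) ≡ det X * det Y
det-· (mat a b c d) (mat e f g h) = lemma a b c d e f g h
  where
  lemma : ∀ a b c d e f g h →
    (a * e + b * g) * (c * f + d * h) - (a * f + b * h) * (c * e + d * g) ≡ (a * d - b * c) * (e * h - f * g)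
  lemma = solve-∀

·-⊙ : ∀ X Y v → (X · Y) ⊙ v ≡ X ⊙ (Y ⊙ v)
·-⊙ (mat a b c d) (mat e f g h) (vec x y) = vec-≡ (entry a b e f g h x y) (entry c d e f g h x y)
  where
  entry : ∀ a b e f g h x y → (a * e + b * g) * x + (a * f + b * h) * y ≡ a * (e * x + f * y) + b * (g * x + h * y)
  entry = solve-∀

*M-·ˡ : ∀ s X Y → s *M X · Y ≡ s *M (X · Y)
*M-·ˡ s (mat a b c d) (mat e f g h) = mat-≡ (entry s a b e g) (entry s a b f h) (entry s c d e g) (entry s c d f h)
  where
  entry : ∀ s a b e g → s * a * e + s * b * g ≡ s * (a * e + b * g)
  entry = solve-∀

*M-·-*M : ∀ s t X Y → (s *M X) · (t *M Y) ≡ (s * t) *M (X · Y)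
*M-·-*M s t (mat a b c d) (mat e f g h) = mat-≡ (entry s t a b e g) (entry s t a b f h) (entry s t c d e g) (entry s t c d f h)
  where
  entry : ∀ s t a b e g → s * a * (t * e) + s * b * (t * g) ≡ s * t * (a * e + b * g)
  entry = solve-∀

*M-identityˡ : ∀ X → 1ℤ *M X ≡ X
*M-identityˡ (mat a b c d) = mat-≡ (ℤ.*-identityˡ a) (ℤ.*-identityˡ b) (ℤ.*-identityˡ c) (ℤ.*-identityˡ d)

det-*M : ∀ s X → det (s *M X) ≡ s * s * det X
det-*M s (mat a b c d) = lemma s a b c d
  where
  lemma : ∀ s a b c d → s * a * (s * d) - s * b * (s * c) ≡ s * s * (a * d - b * c)
  lemma = solve-∀

·-adj : ∀ X → X · adj X ≡ det X *M I2
·-adj (mat a b c d) = mat-≡ (entry₁₁ a b c d) (entry₁₂ a b c d) (entry₂₁ a b c d) (entry₂₂ a b c d)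
  where
  entry₁₁ : ∀ a b c d → a * d + b * (- c) ≡ (a * d - b * c) * 1ℤ
  entry₁₁ = solve-∀
  entry₁₂ : ∀ a b c d → a * (- b) + b * a ≡ (a * d - b * c) * 0ℤ
  entry₁₂ = solve-∀
  entry₂₁ : ∀ a b c d → c * d + d * (- c) ≡ (a * d - b * c) * 0ℤ
  entry₂₁ = solve-∀
  entry₂₂ : ∀ a b c d → c * (- b) + d * a ≡ (a * d - b * c) * 1ℤ
  entry₂₂ = solve-∀

·-*M : ∀ s X Y → X · (s *M Y) ≡ s *M (X · Y)
·-*M s (mat a b c d) (mat e f g h) = mat-≡ (entry s a b e g) (entry s a b f h) (entry s c d e g) (entry s c d f h)
  where
  entry : ∀ s a b e g → a * (s * e) + b * (s * g) ≡ s * (a * e + b * g)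
  entry = solve-∀

*M-*M : ∀ s t X → s *M (t *M X) ≡ (s * t) *M X
*M-*M s t (mat a b c d) = mat-≡ (entry s t a) (entry s t b) (entry s t c) (entry s t d)
  where
  entry : ∀ s t a → s * (t * a) ≡ s * t * a
  entry = solve-∀

diag : ℤ → ℤ → M2
diag a d = mat a 0ℤ 0ℤ d

⊙-*v : ∀ X s v → X ⊙ (s *v v) ≡ s *v (X ⊙ v)
⊙-*v (mat a b c d) s (vec x y) = vec-≡ (entry a b s x y) (entry c d s x y)
  where
  entry : ∀ a b s x y → a * (s * x) + b * (s * y) ≡ s * (a * x + b * y)
  entry = solve-∀

I2-⊙ : ∀ v → I2 ⊙ v ≡ v
I2-⊙ (vec x y) = vec-≡ (top x y) (bottom x y)
  where
  top : ∀ x y → 1ℤ * x + 0ℤ * y ≡ x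
  top = solve-∀
  bottom : ∀ x y → 0ℤ * x + 1ℤ * y ≡ y
  bottom = solve-∀

*v-identityˡ : ∀ u → 1ℤ *v u ≡ u
*v-identityˡ (vec x y) = vec-≡ (ℤ.*-identityˡ x) (ℤ.*-identityˡ y)

diag-·-diag : ∀ a d a' d' → diag a d · diag a' d' ≡ diag (a * a') (d * d')
diag-·-diag a d a' d' = mat-≡ (diagonal a a') (off a d') (off' d a') (diagonal' d d')
  where
  diagonal : ∀ a a' → a * a' + 0ℤ * 0ℤ ≡ a * a'
  diagonal = solve-∀
  off : ∀ a d' → a * 0ℤ + 0ℤ * d' ≡ 0ℤ
  off = solve-∀
  off' : ∀ d a' → 0ℤ * a' + d * 0ℤ ≡ 0ℤ
  off' = solve-∀
  diagonal' : ∀ d d' → 0ℤ * 0ℤ + d * d' ≡ d * d'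
  diagonal' = solve-∀

diag-factor : ∀ P Q → diag P (P * Q) ≡ P *M diag 1ℤ Q
diag-factor P Q = mat-≡ (sym (ℤ.*-identityʳ P)) (sym (ℤ.*-zeroʳ P)) (sym (ℤ.*-zeroʳ P)) refl

·-*M-· : ∀ s U D V → U · (s *M D) · V ≡ s *M (U · D · V)
·-*M-· s U D V = trans (cong (_· V) (·-*M s U D)) (*M-·ˡ s (U · D) V)

infix 4 _≈M[_]_ _≈V[_]_
record _≈M[_]_ (X : M2) (m : ℤ) (Y : M2) : Set where
  constructor ≈M-by
  field
    ≈₁₁ : e11 X ≈[ m ] e11 Y
    ≈₁₂ : e12 X ≈[ m ] e12 Y
    ≈₂₁ : e21 X ≈[ m ] e21 Y
    ≈₂₂ : e22 X ≈[ m ] e22 Y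
open _≈M[_]_ public

record _≈V[_]_ (u : V2) (m : ℤ) (v : V2) : Set where
  constructor ≈V-by
  field
    ≈₁ : c1 u ≈[ m ] c1 v
    ≈₂ : c2 u ≈[ m ] c2 v
open _≈V[_]_ public

≡M⇒≈M : ∀ {X Y m} → X ≡M[ m ] Y → X ≈M[ m ] Y
≡M⇒≈M (a , b , c , d) = ≈M-by (≡[]⇒≈ a) (≡[]⇒≈ b) (≡[]⇒≈ c) (≡[]⇒≈ d)

≈M⇒≡M : ∀ {X Y m} → X ≈M[ m ] Y → X ≡M[ m ] Y
≈M⇒≡M (≈M-by a b c d) = ≈⇒≡[] a , ≈⇒≡[] b , ≈⇒≡[] c , ≈⇒≡[] d

≡V⇒≈V : ∀ {u v m} → u ≡V[ m ] v → u ≈V[ m ] v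
≡V⇒≈V (a , b) = ≈V-by (≡[]⇒≈ a) (≡[]⇒≈ b)

≈V⇒≡V : ∀ {u v m} → u ≈V[ m ] v → u ≡V[ m ] v
≈V⇒≡V (≈V-by a b) = ≈⇒≡[] a , ≈⇒≡[] b

≈M[0]⇒≡ : ∀ {X Y} → X ≈M[ 0ℤ ] Y → X ≡ Y
≈M[0]⇒≡ {mat _ _ _ _} {mat _ _ _ _} (≈M-by a b c d) = mat-≡ (≈[0]⇒≡ a) (≈[0]⇒≡ b) (≈[0]⇒≡ c) (≈[0]⇒≡ d)

≈V[0]⇒≡ : ∀ {u v} → u ≈V[ 0ℤ ] v → u ≡ v
≈V[0]⇒≡ {vec _ _} {vec _ _} (≈V-by a b) = vec-≡ (≈[0]⇒≡ a) (≈[0]⇒≡ b)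

module _ {m : ℤ} where

  ≈M-refl : ∀ {X} → X ≈M[ m ] X
  ≈M-refl = ≈M-by ≈-refl ≈-refl ≈-refl ≈-refl

  ≈M-reflexive : ∀ {X Y} → X ≡ Y → X ≈M[ m ] Y
  ≈M-reflexive refl = ≈M-refl

  ≈M-sym : ∀ {X Y} → X ≈M[ m ] Y → Y ≈M[ m ] X
  ≈M-sym (≈M-by a b c d) = ≈M-by (≈-sym a) (≈-sym b) (≈-sym c) (≈-sym d)

  ≈M-trans : ∀ {X Y Z} → X ≈M[ m ] Y → Y ≈M[ m ] Z → X ≈M[ m ] Z
  ≈M-trans (≈M-by a b c d) (≈M-by a' b' c' d') = ≈M-by (≈-trans a a') (≈-trans b b') (≈-trans c c') (≈-trans d d')

  ≈V-refl : ∀ {u} → u ≈V[ m ] u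
  ≈V-refl = ≈V-by ≈-refl ≈-refl

  ≈V-reflexive : ∀ {u v} → u ≡ v → u ≈V[ m ] v
  ≈V-reflexive refl = ≈V-refl

  ≈V-sym : ∀ {u v} → u ≈V[ m ] v → v ≈V[ m ] u
  ≈V-sym (≈V-by a b) = ≈V-by (≈-sym a) (≈-sym b)

  ≈V-trans : ∀ {u v w} → u ≈V[ m ] v → v ≈V[ m ] w → u ≈V[ m ] w
  ≈V-trans (≈V-by a b) (≈V-by a' b') = ≈V-by (≈-trans a a') (≈-trans b b')

  ·-cong : ∀ {X X' Y Y'} → X ≈M[ m ] X' → Y ≈M[ m ] Y' → X · Y ≈M[ m ] X' · Y'
  ·-cong {mat _ _ _ _} {mat _ _ _ _} {mat _ _ _ _} {mat _ _ _ _} (≈M-by a b c d) (≈M-by e f g h) =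
    ≈M-by (+-cong (*-cong a e) (*-cong b g)) (+-cong (*-cong a f) (*-cong b h))
          (+-cong (*-cong c e) (*-cong d g)) (+-cong (*-cong c f) (*-cong d h))

  ·-congˡ : ∀ X {Y Y'} → Y ≈M[ m ] Y' → X · Y ≈M[ m ] X · Y'
  ·-congˡ X = ·-cong (≈M-refl {X})

  ·-congʳ : ∀ Y {X X'} → X ≈M[ m ] X' → X · Y ≈M[ m ] X' · Y
  ·-congʳ Y h = ·-cong h (≈M-refl {Y})

  ⊙-cong : ∀ {X X' u u'} → X ≈M[ m ] X' → u ≈V[ m ] u' → X ⊙ u ≈V[ m ] X' ⊙ u'
  ⊙-cong {mat _ _ _ _} {mat _ _ _ _} {vec _ _} {vec _ _} (≈M-by a b c d) (≈V-by x y) =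
    ≈V-by (+-cong (*-cong a x) (*-cong b y)) (+-cong (*-cong c x) (*-cong d y))

  +v-cong : ∀ {u u' v v'} → u ≈V[ m ] u' → v ≈V[ m ] v' → u +v v ≈V[ m ] u' +v v'
  +v-cong {vec _ _} {vec _ _} {vec _ _} {vec _ _} (≈V-by a b) (≈V-by c d) = ≈V-by (+-cong a c) (+-cong b d)

  *v-cong : ∀ {s s' u u'} → s ≈[ m ] s' → u ≈V[ m ] u' → s *v u ≈V[ m ] s' *v u'
  *v-cong {u = vec _ _} {vec _ _} h (≈V-by a b) = ≈V-by (*-cong h a) (*-cong h b)

  *M-cong : ∀ {s s' X X'} → s ≈[ m ] s' → X ≈M[ m ] X' → s *M X ≈M[ m ] s' *M X'
  *M-cong {X = mat _ _ _ _} {mat _ _ _ _} h (≈M-by a b c d) = ≈M-by (*-cong h a) (*-cong h b) (*-cong h c) (*-cong h d)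

  det-cong : ∀ {X X'} → X ≈M[ m ] X' → det X ≈[ m ] det X'
  det-cong {mat _ _ _ _} {mat _ _ _ _} (≈M-by a b c d) = sub-cong (*-cong a d) (*-cong b c)

  ≈M-setoid : Setoid _ _
  ≈M-setoid = record
    { Carrier = M2 ; _≈_ = λ X Y → X ≈M[ m ] Y
    ; isEquivalence = record { refl = ≈M-refl ; sym = ≈M-sym ; trans = ≈M-trans } }

  ≈V-setoid : Setoid _ _
  ≈V-setoid = record
    { Carrier = V2 ; _≈_ = λ u v → u ≈V[ m ] v
    ; isEquivalence = record { refl = ≈V-refl ; sym = ≈V-sym ; trans = ≈V-trans } }

  module ≈M-Reasoning = Relation.Binary.Reasoning.Setoid ≈M-setoid
  module ≈V-Reasoning = Relation.Binary.Reasoning.Setoid ≈V-setoid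

module _ {m : ℤ} where

  det-inverse : ∀ X Y → X · Y ≈M[ m ] I2 → det X * det Y ≈[ m ] 1ℤ
  det-inverse X Y e = ≈-trans (≈-reflexive (sym (det-· X Y))) (det-cong e)

  ·-cancelʳ : ∀ X Y V V' → X ≈M[ m ] Y · V → V · V' ≈M[ m ] I2 → X · V' ≈M[ m ] Y
  ·-cancelʳ X Y V V' e e' = begin
    X · V'       ≈⟨ ·-congʳ V' e ⟩
    (Y · V) · V' ≡⟨ ·-assoc Y V V' ⟩
    Y · (V · V') ≈⟨ ·-congˡ Y e' ⟩
    Y · I2       ≡⟨ ·-identityʳ Y ⟩
    Y            ∎
    where open ≈M-Reasoning

  *M-inverse : ∀ {s t} X Y → s * t ≈[ m ] 1ℤ → X · Y ≈M[ m ] I2 → (s *M X) · (t *M Y) ≈M[ m ] I2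
  *M-inverse {s} {t} X Y st e = begin
    (s *M X) · (t *M Y) ≡⟨ *M-·-*M s t X Y ⟩
    (s * t) *M (X · Y)  ≈⟨ *M-cong st e ⟩
    1ℤ *M I2            ≡⟨ *M-identityˡ I2 ⟩
    I2                  ∎
    where open ≈M-Reasoning

  inverse≈adj : ∀ X Y → Y · X ≈M[ m ] I2 → Y ≈M[ m ] det Y *M adj X
  inverse≈adj X Y e = begin
    Y                             ≡⟨ *M-identityˡ Y ⟨
    1ℤ *M Y                       ≈⟨ *M-cong (≈-sym (det-inverse Y X e)) ≈M-refl ⟩
    (det Y * det X) *M Y          ≡⟨ *M-*M (det Y) (det X) Y ⟨
    det Y *M (det X *M Y)         ≡⟨ cong (λ Z → det Y *M (det X *M Z)) (·-identityʳ Y) ⟨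
    det Y *M (det X *M (Y · I2))  ≡⟨ cong (det Y *M_) (·-*M (det X) Y I2) ⟨
    det Y *M (Y · (det X *M I2))  ≡⟨ cong (λ Z → det Y *M (Y · Z)) (·-adj X) ⟨
    det Y *M (Y · (X · adj X))    ≡⟨ cong (det Y *M_) (·-assoc Y X (adj X)) ⟨
    det Y *M ((Y · X) · adj X)    ≈⟨ *M-cong (≈-refl {x = det Y}) (·-congʳ (adj X) e) ⟩
    det Y *M (I2 · adj X)         ≡⟨ cong (det Y *M_) (·-identityˡ (adj X)) ⟩
    det Y *M adj X                ∎
    where open ≈M-Reasoning

  conj-inverse : ∀ A M N Y Y' → A · M ≈M[ m ] Y · A → A · N ≈M[ m ] Y' · A → Y · Y' ≈M[ m ] I2 →
    A · (M · N) ≈M[ m ] A · I2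
  conj-inverse A M N Y Y' eM eN eY = begin
    A · (M · N)   ≡⟨ ·-assoc A M N ⟨
    (A · M) · N   ≈⟨ ·-congʳ N eM ⟩
    (Y · A) · N   ≡⟨ ·-assoc Y A N ⟩
    Y · (A · N)   ≈⟨ ·-congˡ Y eN ⟩
    Y · (Y' · A)  ≡⟨ ·-assoc Y Y' A ⟨
    (Y · Y') · A  ≈⟨ ·-congʳ A eY ⟩
    I2 · A        ≡⟨ ·-identityˡ A ⟩
    A             ≡⟨ ·-identityʳ A ⟨
    A · I2        ∎
    where open ≈M-Reasoning

  conj-back : ∀ B A U V U' V' → B ≈M[ m ] (U · A) · V → U' · U ≈M[ m ] I2 → V · V' ≈M[ m ] I2 →
    (U' · B) · V' ≈M[ m ] A
  conj-back B A U V U' V' h hU hV = begin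
    (U' · B) · V'               ≈⟨ ·-congʳ V' (·-congˡ U' h) ⟩
    (U' · ((U · A) · V)) · V'   ≡⟨ ·-assoc U' ((U · A) · V) V' ⟩
    U' · (((U · A) · V) · V')   ≡⟨ cong (U' ·_) (·-assoc (U · A) V V') ⟩
    U' · ((U · A) · (V · V'))   ≡⟨ ·-assoc U' (U · A) (V · V') ⟨
    (U' · (U · A)) · (V · V')   ≡⟨ cong (_· (V · V')) (·-assoc U' U A) ⟨
    ((U' · U) · A) · (V · V')   ≈⟨ ·-cong (·-congʳ A hU) hV ⟩
    (I2 · A) · I2               ≡⟨ ·-identityʳ (I2 · A) ⟩
    I2 · A                      ≡⟨ ·-identityˡ A ⟩
    A                           ∎
    where open ≈M-Reasoning

-- diag(1,Q)⁻¹ · Y · diag(1,Q), for Y whose (2,1) entry is (congruent to) Q z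
conjDiag : ℤ → M2 → ℤ → M2
conjDiag Q Y z = mat (e11 Y) (Q * e12 Y) z (e22 Y)

module _ {m : ℤ} where

  diag-conjDiag : ∀ P Q Y z → e21 Y ≈[ m ] Q * z →
    diag P (P * Q) · conjDiag Q Y z ≈M[ m ] Y · diag P (P * Q)
  diag-conjDiag P Q (mat a b c d) z h =
    ≈M-by (≈-reflexive (entry₁₁ P a b z)) (≈-reflexive (entry₁₂ P Q a b d))
          (≈-trans (≈-reflexive (entry₂₁ P Q a z d)) (+-cong (*-congʳ P (≈-sym h)) ≈-refl))
          (≈-reflexive (entry₂₂ P Q b c d))
    where
    entry₁₁ : ∀ P a b z → P * a + 0ℤ * z ≡ a * P + b * 0ℤ
    entry₁₁ = solve-∀
    entry₁₂ : ∀ P Q a b d → P * (Q * b) + 0ℤ * d ≡ a * 0ℤ + b * (P * Q)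
    entry₁₂ = solve-∀
    entry₂₁ : ∀ P Q a z d → 0ℤ * a + (P * Q) * z ≡ (Q * z) * P + d * 0ℤ
    entry₂₁ = solve-∀
    entry₂₂ : ∀ P Q b c d → 0ℤ * (Q * b) + (P * Q) * d ≡ c * 0ℤ + d * (P * Q)
    entry₂₂ = solve-∀

  det-conjDiag : ∀ Q Y z → e21 Y ≈[ m ] Q * z → det (conjDiag Q Y z) ≈[ m ] det Y
  det-conjDiag Q (mat a b c d) z h =
    ≈-trans (≈-reflexive (lemma Q a b d z)) (sub-cong (≈-refl {x = a * d}) (*-congˡ b (≈-sym h)))
    where
    lemma : ∀ Q a b d z → a * d - Q * b * z ≡ a * d - b * (Q * z)
    lemma = solve-∀

diag-cancel : ∀ P Q .{{_ : ℤ.NonZero P}} .{{_ : ℤ.NonZero (P * Q)}} {m} M N →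
  diag P (P * Q) · M ≈M[ (P * Q) * m ] diag P (P * Q) · N → M ≈M[ m ] N
diag-cancel P Q {m} (mat a b c d) (mat e f g h) (≈M-by h₁₁ h₁₂ h₂₁ h₂₂) =
  ≈M-by (top c g h₁₁) (top d h h₁₂) (bottom a e h₂₁) (bottom b f h₂₂)
  where
  top-row : ∀ P x y → P * x + 0ℤ * y ≡ P * x
  top-row = solve-∀
  bottom-row : ∀ R x y → 0ℤ * x + R * y ≡ R * y
  bottom-row = solve-∀
  top : ∀ {x x'} y y' → P * x + 0ℤ * y ≈[ (P * Q) * m ] P * x' + 0ℤ * y' → x ≈[ m ] x'
  top {x} {x'} y y' h = ≈-weaken m Q refl (≈-cancelˡ P (subst₂ (λ r n → r ≈[ n ] P * x')
    (top-row P x y) (ℤ.*-assoc P Q m) (≈-trans h (≈-reflexive (top-row P x' y')))))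
  bottom : ∀ {y y'} x x' → 0ℤ * x + (P * Q) * y ≈[ (P * Q) * m ] 0ℤ * x' + (P * Q) * y' → y ≈[ m ] y'
  bottom {y} {y'} x x' h = ≈-cancelˡ (P * Q) (subst (λ r → r ≈[ (P * Q) * m ] (P * Q) * y')
    (bottom-row (P * Q) x y) (≈-trans h (≈-reflexive (bottom-row (P * Q) x' y'))))

unit-square : ∀ x y → x * y ≡ 1ℤ → x * x ≡ 1ℤ
unit-square x y e with ℕ.m*n≡1⇒m≡1 ∣ x ∣ ∣ y ∣ (trans (sym (ℤ.abs-* x y)) (cong ∣_∣ e))
unit-square (+ .1)     y e | refl = refl
unit-square -[1+ 0 ]   y e | refl = refl

det-inverse-≡ : ∀ U V → U · V ≡ I2 → det U * det V ≡ 1ℤ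
det-inverse-≡ U V e = trans (sym (det-· U V)) (cong det e)

GL2ℤ-det² : ∀ {U} → GL2ℤ U → det U * det U ≡ 1ℤ
GL2ℤ-det² {U} (V , e , _) = unit-square (det U) (det V) (det-inverse-≡ U V e)

GL2ℤ-I2 : GL2ℤ I2
GL2ℤ-I2 = I2 , refl , refl

GL2ℤ-inverse : ∀ {U} → (g : GL2ℤ U) → GL2ℤ (proj₁ g)
GL2ℤ-inverse {U} (V , e₁ , e₂) = U , e₂ , e₁

GL2ℤ-· : ∀ {U V} → GL2ℤ U → GL2ℤ V → GL2ℤ (U · V)
GL2ℤ-· {U} {V} (U' , u₁ , u₂) (V' , v₁ , v₂) = V' · U' , cancel U V V' U' v₁ u₁ , cancel V' U' U V u₂ v₂
  where
  open ≡-Reasoning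
  cancel : ∀ X Y Y' X' → Y · Y' ≡ I2 → X · X' ≡ I2 → (X · Y) · (Y' · X') ≡ I2
  cancel X Y Y' X' eY eX = begin
    (X · Y) · (Y' · X')  ≡⟨ ·-assoc X Y (Y' · X') ⟩
    X · (Y · (Y' · X'))  ≡⟨ cong (X ·_) (·-assoc Y Y' X') ⟨
    X · ((Y · Y') · X')  ≡⟨ cong (λ Z → X · (Z · X')) eY ⟩
    X · (I2 · X')        ≡⟨ cong (X ·_) (·-identityˡ X') ⟩
    X · X'               ≡⟨ eX ⟩
    I2                   ∎

GL2ℤ-*M : ∀ {s U} → s * s ≡ 1ℤ → GL2ℤ U → GL2ℤ (s *M U)
GL2ℤ-*M {s} {U} ss (U' , e₁ , e₂) = s *M U' , scaled U U' e₁ , scaled U' U e₂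
  where
  scaled : ∀ X Y → X · Y ≡ I2 → (s *M X) · (s *M Y) ≡ I2
  scaled X Y e = ≈M[0]⇒≡ (*M-inverse {s = s} {t = s} X Y (≈-reflexive ss) (≈M-reflexive e))

pair-≡ : ∀ {A B : M2} {a b : V2} → A ≡ B → a ≡ b → (A , a) ≡ (B , b)
pair-≡ refl refl = refl

eH : HZ
eH = I2 , 0v

∘H-assoc : ∀ x y z → (x ∘H y) ∘H z ≡ x ∘H (y ∘H z)
∘H-assoc (A , vec a₁ a₂) (B , vec b₁ b₂) (C , vec c₁ c₂) = pair-≡ (·-assoc A B C) (translation A B C)
  where
  translation : ∀ A B C → (A · B) ⊙ vec c₁ c₂ +v det C *v ((A ⊙ vec b₁ b₂) +v (det B *v vec a₁ a₂))
                        ≡ A ⊙ ((B ⊙ vec c₁ c₂) +v (det C *v vec b₁ b₂)) +v det (B · C) *v vec a₁ a₂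
  translation (mat a b c d) (mat e f g h) (mat i j k l) =
    vec-≡ (entry a b e f g h i j k l c₁ c₂ b₁ b₂ a₁) (entry c d e f g h i j k l c₁ c₂ b₁ b₂ a₂)
    where
    entry : ∀ a b e f g h i j k l c₁ c₂ b₁ b₂ a₁ →
      (a * e + b * g) * c₁ + (a * f + b * h) * c₂ + (i * l - j * k) * ((a * b₁ + b * b₂) + (e * h - f * g) * a₁)
      ≡ a * (e * c₁ + f * c₂ + (i * l - j * k) * b₁) + b * (g * c₁ + h * c₂ + (i * l - j * k) * b₂)
        + ((e * i + f * k) * (g * j + h * l) - (e * j + f * l) * (g * i + h * k)) * a₁
    entry = solve-∀

∘H-identityˡ : ∀ x → eH ∘H x ≡ x
∘H-identityˡ (mat a b c d , vec a₁ a₂) =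
  pair-≡ (·-identityˡ (mat a b c d)) (vec-≡ (top a b c d a₁ a₂) (bottom a b c d a₁ a₂))
  where
  top : ∀ a b c d a₁ a₂ → 1ℤ * a₁ + 0ℤ * a₂ + (a * d - b * c) * (0ℤ + (1ℤ * 1ℤ - 0ℤ * 0ℤ) * 0ℤ) ≡ a₁
  top = solve-∀
  bottom : ∀ a b c d a₁ a₂ → 0ℤ * a₁ + 1ℤ * a₂ + (a * d - b * c) * (0ℤ + (1ℤ * 1ℤ - 0ℤ * 0ℤ) * 0ℤ) ≡ a₂
  bottom = solve-∀

∘H-identityʳ : ∀ x → x ∘H eH ≡ x
∘H-identityʳ (mat a b c d , vec a₁ a₂) = pair-≡ (·-identityʳ (mat a b c d)) (vec-≡ (entry a b a₁) (entry c d a₂))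
  where
  entry : ∀ a b a₁ → a * 0ℤ + b * 0ℤ + (1ℤ * 1ℤ - 0ℤ * 0ℤ) * a₁ ≡ a₁
  entry = solve-∀

invH : (x : HZ) → InΓH x → HZ
invH (U , u) (U' , _) = U' , (- det U') *v (U' ⊙ u)

*v-cancel : ∀ s t w → s * t ≡ 1ℤ → w +v s *v ((- t) *v w) ≡ 0v
*v-cancel s t (vec x y) e = vec-≡ (entry x) (entry y)
  where
  rearrange : ∀ s t x → x + s * ((- t) * x) ≡ x - (s * t) * x
  rearrange = solve-∀
  cancel : ∀ x → x - 1ℤ * x ≡ 0ℤ
  cancel = solve-∀
  entry : ∀ x → x + s * ((- t) * x) ≡ 0ℤ
  entry x = trans (rearrange s t x) (trans (cong (λ r → x - r * x) e) (cancel x))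

∘H-inverseʳ : ∀ x (g : InΓH x) → x ∘H invH x g ≡ eH
∘H-inverseʳ (U , u) (U' , e , _) = pair-≡ e (begin
  U ⊙ ((- d') *v (U' ⊙ u)) +v d' *v u  ≡⟨ cong (_+v d' *v u) (⊙-*v U (- d') (U' ⊙ u)) ⟩
  (- d') *v (U ⊙ (U' ⊙ u)) +v d' *v u  ≡⟨ cong (λ w → (- d') *v w +v d' *v u) (·-⊙ U U' u) ⟨
  (- d') *v ((U · U') ⊙ u) +v d' *v u  ≡⟨ cong (λ Z → (- d') *v (Z ⊙ u) +v d' *v u) e ⟩
  (- d') *v (I2 ⊙ u) +v d' *v u        ≡⟨ cong (λ w → (- d') *v w +v d' *v u) (I2-⊙ u) ⟩
  (- d') *v u +v d' *v u               ≡⟨ negate d' u ⟩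
  0v                                 ∎)
  where
  open ≡-Reasoning
  d' = det U'
  negate : ∀ s u → (- s) *v u +v s *v u ≡ 0v
  negate s (vec x y) = vec-≡ (entry s x) (entry s y)
    where
    entry : ∀ s x → (- s) * x + s * x ≡ 0ℤ
    entry = solve-∀

∘H-inverseˡ : ∀ x (g : InΓH x) → invH x g ∘H x ≡ eH
∘H-inverseˡ (U , u) (U' , e₁ , e₂) = pair-≡ e₂ (*v-cancel (det U) (det U') (U' ⊙ u) (det-inverse-≡ U U' e₁))

InDCℤ-refl : ∀ β → InDCℤ β β
InDCℤ-refl β = eH , eH , GL2ℤ-I2 , GL2ℤ-I2 , sym (trans (cong (_∘H eH) (∘H-identityˡ β)) (∘H-identityʳ β))

InDCℤ-transfer : ∀ {β β' g₁ g₂} → InΓH g₁ → InΓH g₂ → β ≡ g₁ ∘H β' ∘H g₂ →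
  ∀ x → InDCℤ β x → InDCℤ β' x
InDCℤ-transfer {β} {β'} {g₁} {g₂} Γ₁ Γ₂ e x (h₁ , h₂ , Γh₁ , Γh₂ , ex) =
  h₁ ∘H g₁ , g₂ ∘H h₂ , GL2ℤ-· Γh₁ Γ₁ , GL2ℤ-· Γ₂ Γh₂ , (begin
    x                                    ≡⟨ ex ⟩
    h₁ ∘H β ∘H h₂                        ≡⟨ cong (λ z → h₁ ∘H z ∘H h₂) e ⟩
    h₁ ∘H (g₁ ∘H β' ∘H g₂) ∘H h₂         ≡⟨ cong (_∘H h₂) (∘H-assoc h₁ (g₁ ∘H β') g₂) ⟨
    h₁ ∘H (g₁ ∘H β') ∘H g₂ ∘H h₂         ≡⟨ cong (λ z → z ∘H g₂ ∘H h₂) (∘H-assoc h₁ g₁ β') ⟨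
    h₁ ∘H g₁ ∘H β' ∘H g₂ ∘H h₂           ≡⟨ ∘H-assoc (h₁ ∘H g₁ ∘H β') g₂ h₂ ⟩
    h₁ ∘H g₁ ∘H β' ∘H (g₂ ∘H h₂)         ∎)
  where open ≡-Reasoning

solve-∘H : ∀ {β β' g₁ g₂} (Γ₁ : InΓH g₁) (Γ₂ : InΓH g₂) → β ≡ g₁ ∘H β' ∘H g₂ →
  β' ≡ invH g₁ Γ₁ ∘H β ∘H invH g₂ Γ₂
solve-∘H {β} {β'} {g₁} {g₂} Γ₁ Γ₂ e = sym (begin
  i₁ ∘H β ∘H i₂                       ≡⟨ cong (λ z → i₁ ∘H z ∘H i₂) e ⟩
  i₁ ∘H (g₁ ∘H β' ∘H g₂) ∘H i₂        ≡⟨ ∘H-assoc i₁ (g₁ ∘H β' ∘H g₂) i₂ ⟩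
  i₁ ∘H (g₁ ∘H β' ∘H g₂ ∘H i₂)        ≡⟨ cong (i₁ ∘H_) (∘H-assoc (g₁ ∘H β') g₂ i₂) ⟩
  i₁ ∘H (g₁ ∘H β' ∘H (g₂ ∘H i₂))      ≡⟨ cong (λ z → i₁ ∘H (g₁ ∘H β' ∘H z)) (∘H-inverseʳ g₂ Γ₂) ⟩
  i₁ ∘H (g₁ ∘H β' ∘H eH)              ≡⟨ cong (i₁ ∘H_) (∘H-identityʳ (g₁ ∘H β')) ⟩
  i₁ ∘H (g₁ ∘H β')                    ≡⟨ ∘H-assoc i₁ g₁ β' ⟨
  i₁ ∘H g₁ ∘H β'                      ≡⟨ cong (_∘H β') (∘H-inverseˡ g₁ Γ₁) ⟩
  eH ∘H β'                            ≡⟨ ∘H-identityˡ β' ⟩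
  β'                                  ∎)
  where
  open ≡-Reasoning
  i₁ = invH g₁ Γ₁
  i₂ = invH g₂ Γ₂

InDCℤ-≡ : ∀ {β β' g₁ g₂} → InΓH g₁ → InΓH g₂ → β ≡ g₁ ∘H β' ∘H g₂ →
  ∀ x → InDCℤ β x ⇔ InDCℤ β' x
InDCℤ-≡ {g₁ = g₁} {g₂} Γ₁ Γ₂ e x =
  mk⇔ (InDCℤ-transfer Γ₁ Γ₂ e x) (InDCℤ-transfer (GL2ℤ-inverse Γ₁) (GL2ℤ-inverse Γ₂) (solve-∘H Γ₁ Γ₂ e) x)

regroup-translation : ∀ A V' U v c u s →
  (A · V') ⊙ v +v s *v (U ⊙ c +v det A *v u) ≡ (s *M U) ⊙ c +v A ⊙ (V' ⊙ v +v s *v (adj A ⊙ u))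
regroup-translation (mat a b c d) (mat e f g h) (mat i j k l) (vec v₁ v₂) (vec c₁ c₂) (vec u₁ u₂) s =
  vec-≡ (top a b c d e f g h i j v₁ v₂ c₁ c₂ u₁ u₂ s) (bottom a b c d e f g h k l v₁ v₂ c₁ c₂ u₁ u₂ s)
  where
  top : ∀ a b c d e f g h i j v₁ v₂ c₁ c₂ u₁ u₂ s →
    (a * e + b * g) * v₁ + (a * f + b * h) * v₂ + s * ((i * c₁ + j * c₂) + (a * d - b * c) * u₁)
    ≡ (s * i * c₁ + s * j * c₂) + (a * ((e * v₁ + f * v₂) + s * (d * u₁ + (- b) * u₂))
                                   + b * ((g * v₁ + h * v₂) + s * ((- c) * u₁ + a * u₂)))
  top = solve-∀
  bottom : ∀ a b c d e f g h k l v₁ v₂ c₁ c₂ u₁ u₂ s →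
    (c * e + d * g) * v₁ + (c * f + d * h) * v₂ + s * ((k * c₁ + l * c₂) + (a * d - b * c) * u₂)
    ≡ (s * k * c₁ + s * l * c₂) + (c * ((e * v₁ + f * v₂) + s * (d * u₁ + (- b) * u₂))
                                   + d * ((g * v₁ + h * v₂) + s * ((- c) * u₁ + a * u₂)))
  bottom = solve-∀

module _ {m : ℤ} where

  translation-from-double-coset : ∀ A U V V' u v c b →
    A ≈M[ m ] (U · A) · V → V · V' ≈M[ m ] I2 → b ≈V[ m ] (U · A) ⊙ v +v det V *v (U ⊙ c +v det A *v u) →
    (A · V' ≈M[ m ] U · A) × (b ≈V[ m ] (det V *M U) ⊙ c +v A ⊙ (V' ⊙ v +v det V *v (adj A ⊙ u)))
  translation-from-double-coset A U V V' u v c b hA hV hb = AV'≈UA , (begin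
    b                                                   ≈⟨ hb ⟩
    (U · A) ⊙ v +v det V *v (U ⊙ c +v det A *v u)       ≈⟨ +v-cong (⊙-cong (≈M-sym AV'≈UA) ≈V-refl) ≈V-refl ⟩
    (A · V') ⊙ v +v det V *v (U ⊙ c +v det A *v u)      ≡⟨ regroup-translation A V' U v c u (det V) ⟩
    (det V *M U) ⊙ c +v A ⊙ (V' ⊙ v +v det V *v (adj A ⊙ u)) ∎)
    where
    open ≈V-Reasoning
    AV'≈UA : A · V' ≈M[ m ] U · A
    AV'≈UA = ·-cancelʳ A (U · A) V V' hA hV

  e21-from-conj : ∀ P Q .{{_ : ℤ.NonZero P}} U V' →
    U · diag P (P * Q) ≈M[ P * m ] diag P (P * Q) · V' → e21 U ≈[ m ] Q * e21 V'
  e21-from-conj P Q (mat a b c d) (mat e f g h) eq =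
    ≈-cancelˡ P (≈-trans (≈-reflexive (left P c d)) (≈-trans (≈₂₁ eq) (≈-reflexive (right P Q e g))))
    where
    left : ∀ P c d → P * c ≡ c * P + d * 0ℤ
    left = solve-∀
    right : ∀ P Q e g → 0ℤ * e + (P * Q) * g ≡ P * (Q * g)
    right = solve-∀

regroup-untwisted : ∀ M Y s t d c v → M ⊙ v +v s *v ((t *M Y) ⊙ c +v d *v 0v) ≡ (s * t) *v (Y ⊙ c) +v M ⊙ v
regroup-untwisted (mat a b c d) (mat e f g h) s t w (vec c₁ c₂) (vec v₁ v₂) =
  vec-≡ (entry a b e f s t w c₁ c₂ v₁ v₂) (entry c d g h s t w c₁ c₂ v₁ v₂)
  where
  entry : ∀ a b e f s t w c₁ c₂ v₁ v₂ → a * v₁ + b * v₂ + s * ((t * e * c₁ + t * f * c₂) + w * 0ℤ)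
    ≡ (s * t) * (e * c₁ + f * c₂) + (a * v₁ + b * v₂)
  entry = solve-∀

-- V₀ is invertible with inverse W₀
-- only after cancelling A, which needs a finer modulus; hence V·V' takes it as a hypothesis.
module Untwist {m : ℤ} (P Q : ℤ) (X Y : M2) (y : ℤ)
  (XY : X · Y ≈M[ m ] I2) (YX : Y · X ≈M[ m ] I2) (hy : e21 X ≈[ m ] Q * y) where

  A : M2
  A = diag P (P * Q)

  z : ℤ
  z = - (det Y * y)

  e21-Y : e21 Y ≈[ m ] Q * z
  e21-Y = ≈-trans (≈₂₁ (inverse≈adj X Y YX))
    (≈-trans (*-congˡ (det Y) (-‿cong hy)) (≈-reflexive (lemma (det Y) y Q)))
    where
    lemma : ∀ d y Q → d * (- (Q * y)) ≡ Q * (- (d * y))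
    lemma = solve-∀

  V₀ : M2
  V₀ = conjDiag Q Y z

  W₀ : M2
  W₀ = conjDiag Q X y

  A·V₀ : A · V₀ ≈M[ m ] Y · A
  A·V₀ = diag-conjDiag P Q Y z e21-Y

  A·W₀ : A · W₀ ≈M[ m ] X · A
  A·W₀ = diag-conjDiag P Q X y hy

  U : M2
  U = det Y *M X

  V : M2
  V = det X *M V₀

  UAV≈A : (U · A) · V ≈M[ m ] A
  UAV≈A = begin
    (det Y *M X · A) · (det X *M V₀)      ≡⟨ cong (_· (det X *M V₀)) (*M-·ˡ (det Y) X A) ⟩
    (det Y *M (X · A)) · (det X *M V₀)    ≡⟨ *M-·-*M (det Y) (det X) (X · A) V₀ ⟩
    (det Y * det X) *M ((X · A) · V₀)     ≈⟨ *M-cong (det-inverse Y X YX) ≈M-refl ⟩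
    1ℤ *M ((X · A) · V₀)                  ≡⟨ *M-identityˡ ((X · A) · V₀) ⟩
    (X · A) · V₀                          ≡⟨ ·-assoc X A V₀ ⟩
    X · (A · V₀)                          ≈⟨ ·-congˡ X A·V₀ ⟩
    X · (Y · A)                           ≡⟨ ·-assoc X Y A ⟨
    (X · Y) · A                           ≈⟨ ·-congʳ A XY ⟩
    I2 · A                                ≡⟨ ·-identityˡ A ⟩
    A                                     ∎
    where open ≈M-Reasoning

  det-V : det V * det Y ≈[ m ] 1ℤ
  det-V = begin
    det (det X *M V₀) * det Y                  ≡⟨ cong (_* det Y) (det-*M (det X) V₀) ⟩
    det X * det X * det V₀ * det Y             ≈⟨ *-congʳ (det Y) (*-congˡ (det X * det X) (det-conjDiag Q Y z e21-Y)) ⟩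
    det X * det X * det Y * det Y              ≡⟨ lemma (det X) (det Y) ⟩
    (det X * det Y) * (det X * det Y)          ≈⟨ *-cong (det-inverse X Y XY) (det-inverse X Y XY) ⟩
    1ℤ * 1ℤ                                    ∎
    where
    open ≈-Reasoning
    lemma : ∀ a b → a * a * b * b ≡ (a * b) * (a * b)
    lemma = solve-∀

  A·V₀W₀ : A · (V₀ · W₀) ≈M[ m ] A · I2
  A·V₀W₀ = conj-inverse A V₀ W₀ Y X A·V₀ A·W₀ YX

  A·W₀V₀ : A · (W₀ · V₀) ≈M[ m ] A · I2
  A·W₀V₀ = conj-inverse A W₀ V₀ X Y A·W₀ A·V₀ XY

  U·U' : U · (det X *M Y) ≈M[ m ] I2
  U·U' = *M-inverse {s = det Y} {t = det X} X Y (det-inverse Y X YX) XY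

  U'·U : (det X *M Y) · U ≈M[ m ] I2
  U'·U = *M-inverse {s = det X} {t = det Y} Y X (det-inverse X Y XY) YX

  V·V' : V₀ · W₀ ≈M[ m ] I2 → V · (det Y *M W₀) ≈M[ m ] I2
  V·V' = *M-inverse {s = det X} {t = det Y} V₀ W₀ (det-inverse X Y XY)

  V'·V : W₀ · V₀ ≈M[ m ] I2 → (det Y *M W₀) · V ≈M[ m ] I2
  V'·V = *M-inverse {s = det Y} {t = det X} W₀ V₀ (det-inverse Y X YX)

  translation : ∀ b c w → b ≈V[ m ] X ⊙ c +v A ⊙ w →
    b ≈V[ m ] (U · A) ⊙ (V ⊙ w) +v det V *v (U ⊙ c +v det A *v 0v)
  translation b c w hb = begin
    b                                                  ≈⟨ hb ⟩
    X ⊙ c +v A ⊙ w                                     ≡⟨ cong (_+v A ⊙ w) (*v-identityˡ (X ⊙ c)) ⟨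
    1ℤ *v (X ⊙ c) +v A ⊙ w                             ≈⟨ +v-cong (*v-cong (≈-sym det-V) ≈V-refl) ≈V-refl ⟩
    (det V * det Y) *v (X ⊙ c) +v A ⊙ w                ≡⟨ regroup-untwisted A X (det V) (det Y) (det A) c w ⟨
    A ⊙ w +v det V *v (U ⊙ c +v det A *v 0v)           ≈⟨ +v-cong (⊙-cong (≈M-sym UAV≈A) ≈V-refl) ≈V-refl ⟩
    ((U · A) · V) ⊙ w +v det V *v (U ⊙ c +v det A *v 0v)
      ≡⟨ cong (_+v det V *v (U ⊙ c +v det A *v 0v)) (·-⊙ (U · A) V w) ⟩
    (U · A) ⊙ (V ⊙ w) +v det V *v (U ⊙ c +v det A *v 0v) ∎
    where open ≈V-Reasoning

multiple⇒∣ : ∀ {m x} t → x ≡ m * t → m ∣ x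
multiple⇒∣ {m} t e = Signed.∣⇒∣ᵤ (Signed.divides t (trans e (ℤ.*-comm m t)))

∣⇒multiple : ∀ {m x} → m ∣ x → Σ ℤ λ t → x ≡ m * t
∣⇒multiple {m} {x} m∣x with Signed.∣ᵤ⇒∣ {m} {x} m∣x
... | Signed.divides t e = t , trans e (ℤ.*-comm t m)

sameDoubleCoset⇒Γ₀-translate : ∀ P Q .{{_ : ℤ.NonZero P}} A → A ≡ diag P (P * Q) → ∀ b c →
  ((x : HZ) → InDCℤ (A , b) x ⇔ InDCℤ (A , c) x) →
  Σ M2 λ X → GL2ℤ X × (Q ∣ e21 X) × Σ V2 λ w → b ≡ X ⊙ c +v A ⊙ w
sameDoubleCoset⇒Γ₀-translate P Q _ refl b c H
  with Equivalence.to (H (diag P (P * Q) , b)) (InDCℤ-refl _)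
... | (U , u) , (V , v) , GL-U , GL-V@(V' , VV' , _) , e =
  det V *M U , GL2ℤ-*M {det V} (GL2ℤ-det² GL-V) GL-U ,
  multiple⇒∣ {Q} (det V * e21 V') e21-X , _ , ≈V[0]⇒≡ b≈
  where
  A = diag P (P * Q)
  decomposition = translation-from-double-coset A U V V' u v c b
    (≈M-reflexive (cong proj₁ e)) (≈M-reflexive VV') (≈V-reflexive (cong proj₂ e))
  b≈ = proj₂ decomposition
  e21-U : e21 U ≡ Q * e21 V'
  e21-U = ≈[0]⇒≡ (e21-from-conj P Q U V' (subst (λ n → U · A ≈M[ n ] A · V') (sym (ℤ.*-zeroʳ P))
            (≈M-sym (proj₁ decomposition))))
  e21-X : det V * e21 U ≡ Q * (det V * e21 V')
  e21-X = trans (cong (det V *_) e21-U) (lemma (det V) Q (e21 V'))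
    where
    lemma : ∀ s Q w → s * (Q * w) ≡ Q * (s * w)
    lemma = solve-∀

Γ₀-translate⇒sameDoubleCoset : ∀ P Q .{{_ : ℤ.NonZero P}} .{{_ : ℤ.NonZero (P * Q)}} A → A ≡ diag P (P * Q) →
  ∀ b c X → GL2ℤ X → Q ∣ e21 X → (w : V2) → b ≡ X ⊙ c +v A ⊙ w →
  (x : HZ) → InDCℤ (A , b) x ⇔ InDCℤ (A , c) x
Γ₀-translate⇒sameDoubleCoset P Q _ refl b c X (X' , XX' , X'X) Q∣e21 w hb =
  InDCℤ-≡ {g₁ = U , 0v} {g₂ = V , V ⊙ w} GL-U GL-V
    (pair-≡ (sym (≈M[0]⇒≡ UAV≈A)) (≈V[0]⇒≡ (translation b c w (≈V-reflexive hb))))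
  where
  multiple = ∣⇒multiple {Q} {e21 X} Q∣e21
  open Untwist P Q X X' (proj₁ multiple) (≈M-reflexive XX') (≈M-reflexive X'X) (≈-reflexive (proj₂ multiple))
  cancel : ∀ M → A · M ≈M[ 0ℤ ] A · I2 → M ≈M[ 0ℤ ] I2
  cancel M h = diag-cancel P Q M I2 (subst (λ n → A · M ≈M[ n ] A · I2) (sym (ℤ.*-zeroʳ (P * Q))) h)
  GL-U : GL2ℤ U
  GL-U = det X *M X' , ≈M[0]⇒≡ U·U' , ≈M[0]⇒≡ U'·U
  GL-V : GL2ℤ V
  GL-V = det X' *M W₀ ,
    ≈M[0]⇒≡ (V·V' (cancel (V₀ · W₀) A·V₀W₀)) , ≈M[0]⇒≡ (V'·V (cancel (W₀ · V₀) A·W₀V₀))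

prime≢1 : ∀ {r} → Prime r → r ≢ 1
prime≢1 pr refl = ¬prime[1] pr

prime∣^⇒∣ : ∀ {r p} → Prime r → ∀ k → r ℕ.∣ p ^ k → r ℕ.∣ p
prime∣^⇒∣ pr zero h = ⊥-elim (prime≢1 pr (ℕ.∣1⇒≡1 h))
prime∣^⇒∣ {p = p} pr (suc k) h with euclidsLemma p (p ^ k) pr h
... | inj₁ r∣p = r∣p
... | inj₂ r∣p^k = prime∣^⇒∣ pr k r∣p^k

prime∣prime⇒≡ : ∀ {r p} → Prime r → Prime p → r ℕ.∣ p → r ≡ p
prime∣prime⇒≡ pr pp h with prime⇒irreducible pp h
... | inj₁ r≡1 = ⊥-elim (prime≢1 pr r≡1)
... | inj₂ r≡p = r≡p

∃-prime-divisor : ∀ n → n ≢ 0 → n ≢ 1 → Σ ℕ λ r → Prime r × r ℕ.∣ n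
∃-prime-divisor zero n≢0 _ = ⊥-elim (n≢0 refl)
∃-prime-divisor n@(suc _) _ n≢1 with factorise n
... | record { factors = [] ; isFactorisation = e } = ⊥-elim (n≢1 e)
... | record { factors = r ∷ rs ; isFactorisation = e ; factorsPrime = pr ∷ _ } =
  r , pr , subst (r ℕ.∣_) (sym e) (ℕ.m∣m*n (product rs))

noPrimeDivisor⇒≡1 : ∀ n → n ≢ 0 → (∀ r → Prime r → r ℕ.∣ n → ⊥) → n ≡ 1
noPrimeDivisor⇒≡1 n n≢0 h with n ℕ.≟ 1
... | yes n≡1 = n≡1
... | no n≢1 with ∃-prime-divisor n n≢0 n≢1
...   | r , pr , r∣n = ⊥-elim (h r pr r∣n)

coprime-^ : ∀ {p q} → Prime p → Prime q → q ≢ p → ∀ e n → Coprime (p ^ e) (q ^ n)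
coprime-^ {p} {q} pp pq q≢p e n {i} (i∣p^e , i∣q^n) = noPrimeDivisor⇒≡1 i i≢0 no-prime
  where
  i≢0 : i ≢ 0
  i≢0 refl = ℕ.≢-nonZero⁻¹ (p ^ e) {{ℕ.m^n≢0 p e {{prime⇒nonZero pp}}}} (ℕ.0∣⇒≡0 i∣p^e)
  no-prime : ∀ r → Prime r → r ℕ.∣ i → ⊥
  no-prime r pr r∣i = q≢p (trans (sym (prime∣prime⇒≡ pr pq (prime∣^⇒∣ pr n (ℕ.∣-trans r∣i i∣q^n))))
                                  (prime∣prime⇒≡ pr pp (prime∣^⇒∣ pr e (ℕ.∣-trans r∣i i∣p^e))))

sign-factor : ∀ a → Σ ℤ λ σ → + ∣ a ∣ ≡ σ * a
sign-factor (+ n) = 1ℤ , sym (ℤ.*-identityˡ (+ n))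
sign-factor -[1+ n ] = -1ℤ , sym (ℤ.-1*i≡-i -[1+ n ])

private
  Bézout-cast : ∀ {A B} x y σa σb a b → + A ≡ σa * a → + B ≡ σb * b → 1 ℕ.+ y ℕ.* B ≡ x ℕ.* A →
    1ℤ + + y * (σb * b) ≡ + x * (σa * a)
  Bézout-cast {A} {B} x y σa σb a b ea eb eq = subst₂ (λ u v → 1ℤ + + y * u ≡ + x * v) eb ea
    (trans (cong (λ r → 1ℤ + r) (sym (ℤ.pos-* y B)))
      (trans (sym (ℤ.pos-+ 1 (y ℕ.* B))) (trans (cong +_ eq) (ℤ.pos-* x A))))

  Bézout-combine : ∀ x y σa σb a b → 1ℤ + y * (σb * b) ≡ x * (σa * a) → (x * σa) * a + (- (y * σb)) * b ≡ 1ℤ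
  Bézout-combine x y σa σb a b e = begin
    (x * σa) * a + (- (y * σb)) * b      ≡⟨ regroup x y σa σb a b ⟩
    x * (σa * a) - y * (σb * b)          ≡⟨ cong (_- y * (σb * b)) e ⟨
    (1ℤ + y * (σb * b)) - y * (σb * b)   ≡⟨ cancel (y * (σb * b)) ⟩
    1ℤ                                   ∎
    where
    open ≡-Reasoning
    regroup : ∀ x y σa σb a b → (x * σa) * a + (- (y * σb)) * b ≡ x * (σa * a) - y * (σb * b)
    regroup = solve-∀
    cancel : ∀ z → (1ℤ + z) - z ≡ 1ℤ
    cancel = solve-∀

ℤ-Bézout : ∀ a b → Coprime ∣ a ∣ ∣ b ∣ → Σ ℤ λ s → Σ ℤ λ t → s * a + t * b ≡ 1ℤ
ℤ-Bézout a b cop with coprime-Bézout cop | sign-factor a | sign-factor b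
... | Bézout.+- x y eq | σa , ea | σb , eb =
  + x * σa , - (+ y * σb) , Bézout-combine (+ x) (+ y) σa σb a b (Bézout-cast x y σa σb a b ea eb eq)
... | Bézout.-+ x y eq | σa , ea | σb , eb =
  - (+ x * σa) , + y * σb , trans (ℤ.+-comm (- (+ x * σa) * a) (+ y * σb * b))
    (Bézout-combine (+ y) (+ x) σb σa b a (Bézout-cast y x σb σa b a eb ea eq))

pw-+ : ∀ q d n → pw q (d ℕ.+ n) ≡ pw q d * pw q n
pw-+ q d n = trans (cong +_ (ℕ.^-distribˡ-+-* q d n)) (ℤ.pos-* (q ^ d) (q ^ n))

pw-+ʳ : ∀ q n d → pw q (n ℕ.+ d) ≡ pw q d * pw q n
pw-+ʳ q n d = trans (cong (pw q) (ℕ.+-comm n d)) (pw-+ q d n)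

pw≢0 : ∀ {p} → Prime p → ∀ n → ℤ.NonZero (pw p n)
pw≢0 {p} pp n = ℕ.m^n≢0 p n {{prime⇒nonZero pp}}

module _ {q : ℕ} where

  mkZ : (s : ℕ → ℤ) → (∀ n → s (suc n) ≈[ pw q n ] s n) → Zq q
  mkZ s h = record { seq = s ; coh = λ n → ≈⇒≡[] (h n) }

  mkMq : (f : ℕ → M2) → (∀ n → f (suc n) ≈M[ pw q n ] f n) → M2q q
  mkMq f h = record
    { f11 = mkZ (λ n → e11 (f n)) (λ n → ≈₁₁ (h n)) ; f12 = mkZ (λ n → e12 (f n)) (λ n → ≈₁₂ (h n))
    ; f21 = mkZ (λ n → e21 (f n)) (λ n → ≈₂₁ (h n)) ; f22 = mkZ (λ n → e22 (f n)) (λ n → ≈₂₂ (h n)) }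

  mkVq : (f : ℕ → V2) → (∀ n → f (suc n) ≈V[ pw q n ] f n) → V2q q
  mkVq f h = record { g1 = mkZ (λ n → c1 (f n)) (λ n → ≈₁ (h n)) ; g2 = mkZ (λ n → c2 (f n)) (λ n → ≈₂ (h n)) }

  coh≈ : ∀ (x : Zq q) n → seq x (suc n) ≈[ pw q n ] seq x n
  coh≈ x n = ≡[]⇒≈ (coh x n)

  cohM : ∀ (X : M2q q) n → X atM suc n ≈M[ pw q n ] X atM n
  cohM X n = ≈M-by (coh≈ (f11 X) n) (coh≈ (f12 X) n) (coh≈ (f21 X) n) (coh≈ (f22 X) n)

  cohV : ∀ (v : V2q q) n → v atV suc n ≈V[ pw q n ] v atV n
  cohV v n = ≈V-by (coh≈ (g1 v) n) (coh≈ (g2 v) n)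

  coh-step : ∀ (x : Zq q) n d → seq x (suc (n ℕ.+ d)) ≈[ pw q n ] seq x (n ℕ.+ d)
  coh-step x n d = ≈-weaken (pw q n) (pw q d) (pw-+ʳ q n d) (coh≈ x (n ℕ.+ d))

  coh-+ : ∀ (x : Zq q) n d → seq x (n ℕ.+ d) ≈[ pw q n ] seq x n
  coh-+ x n zero = ≈-reflexive (cong (seq x) (ℕ.+-identityʳ n))
  coh-+ x n (suc d) =
    ≈-trans (≈-reflexive (cong (seq x) (ℕ.+-suc n d))) (≈-trans (coh-step x n d) (coh-+ x n d))

  cohM-+ : ∀ (X : M2q q) n d → X atM (n ℕ.+ d) ≈M[ pw q n ] X atM n
  cohM-+ X n d = ≈M-by (coh-+ (f11 X) n d) (coh-+ (f12 X) n d) (coh-+ (f21 X) n d) (coh-+ (f22 X) n d)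

  constZ : ℤ → Zq q
  constZ x = mkZ (λ _ → x) (λ _ → ≈-refl)

  constM : M2 → M2q q
  constM X = mkMq (λ _ → X) (λ _ → ≈M-refl)

  constV : V2 → V2q q
  constV v = mkVq (λ _ → v) (λ _ → ≈V-refl)

  infixl 7 _*Z_
  _*Z_ : Zq q → Zq q → Zq q
  x *Z y = mkZ (λ n → seq x n * seq y n) (λ n → *-cong (coh≈ x n) (coh≈ y n))

  -Z_ : Zq q → Zq q
  -Z x = mkZ (λ n → - seq x n) (λ n → -‿cong (coh≈ x n))

  shiftZ : ℕ → Zq q → Zq q
  shiftZ d x = mkZ (λ n → seq x (n ℕ.+ d))
    (λ n → coh-step x n d)

  detq : M2q q → Zq q
  detq X = mkZ (λ n → det (X atM n)) (λ n → det-cong (cohM X n))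

  infixl 7 _·q_ _*Mq_ _⊙q_
  _·q_ : M2q q → M2q q → M2q q
  X ·q Y = mkMq (λ n → X atM n · Y atM n) (λ n → ·-cong (cohM X n) (cohM Y n))

  _*Mq_ : Zq q → M2q q → M2q q
  s *Mq X = mkMq (λ n → seq s n *M X atM n) (λ n → *M-cong (coh≈ s n) (cohM X n))

  _⊙q_ : M2q q → V2q q → V2q q
  X ⊙q v = mkVq (λ n → X atM n ⊙ v atV n) (λ n → ⊙-cong (cohM X n) (cohV v n))

  infixl 6 _+vq_
  _+vq_ : V2q q → V2q q → V2q q
  u +vq v = mkVq (λ n → u atV n +v v atV n) (λ n → +v-cong (cohV u n) (cohV v n))

  _*vq_ : Zq q → V2q q → V2q q
  s *vq v = mkVq (λ n → seq s n *v (v atV n)) (λ n → *v-cong (coh≈ s n) (cohV v n))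

module _ {q : ℕ} where

  unitZq : ∀ x → (∀ n → Σ ℤ λ s → x * s ≈[ pw q n ] 1ℤ) → Σ (Zq q) λ s → ∀ n → x * seq s n ≈[ pw q n ] 1ℤ
  unitZq x inverse = mkZ (λ n → proj₁ (inverse n)) coherent , λ n → proj₂ (inverse n)
    where
    -- inverses modulo q^(n+1) and q^n agree modulo q^n, since inverses are unique
    coherent : ∀ n → proj₁ (inverse (suc n)) ≈[ pw q n ] proj₁ (inverse n)
    coherent n = begin
      s'             ≡⟨ ℤ.*-identityʳ s' ⟨
      s' * 1ℤ        ≈⟨ *-congˡ s' (≈-sym (proj₂ (inverse n))) ⟩
      s' * (x * s)   ≡⟨ regroup s' x s ⟩
      (x * s') * s   ≈⟨ *-congʳ s (≈-weaken (pw q n) (+ q) (ℤ.pos-* q (q ^ n)) (proj₂ (inverse (suc n)))) ⟩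
      1ℤ * s         ≡⟨ ℤ.*-identityˡ s ⟩
      s              ∎
      where
      open ≈-Reasoning
      s' = proj₁ (inverse (suc n))
      s = proj₁ (inverse n)
      regroup : ∀ a x b → a * (x * b) ≡ (x * a) * b
      regroup = solve-∀

^-invertible : ∀ {p q} → Prime p → Prime q → q ≢ p → ∀ e n → Σ ℤ λ s → pw p e * s ≈[ pw q n ] 1ℤ
^-invertible {p} {q} pp pq q≢p e n with ℤ-Bézout (pw p e) (pw q n) (coprime-^ pp pq q≢p e n)
... | s , t , st = s , ≈-by (- t) (trans (lemma (pw p e) s t (pw q n)) (cong (λ r → r + (- t) * pw q n) st))
  where
  lemma : ∀ P s t Q → P * s ≡ (s * P + t * Q) + (- t) * Q
  lemma = solve-∀

q-component : ∀ {q} x y b →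
  (∀ n → Σ ℤ λ s → x * s ≈[ pw q n ] 1ℤ) → (∀ n → Σ ℤ λ t → y * t ≈[ pw q n ] 1ℤ) →
  InDCq q (I2 , 0v) (diag x y , b)
q-component {q} x y b x⁻¹ y⁻¹ =
  (constM D , constV b) , (constM I2 , constV 0v) , GL-D , GL-I2 ,
  λ n → ≈M⇒≡M {m = pw q n} (≈M-reflexive (cong proj₁ unit)) ,
        ≈V⇒≡V {m = pw q n} (≈V-reflexive (cong proj₂ unit))
  where
  D = diag x y
  s = unitZq x x⁻¹
  t = unitZq y y⁻¹
  D⁻¹ : M2q q
  D⁻¹ = record { f11 = proj₁ s ; f12 = constZ 0ℤ ; f21 = constZ 0ℤ ; f22 = proj₁ t }
  inverse : ∀ {m} a d a' d' → a * a' ≈[ m ] 1ℤ → d * d' ≈[ m ] 1ℤ → diag a d · diag a' d' ≡M[ m ] I2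
  inverse {m} a d a' d' aa' dd' =
    ≈M⇒≡M {m = m} (≈M-trans (≈M-reflexive (diag-·-diag a d a' d')) (≈M-by aa' ≈-refl ≈-refl dd'))
  GL-D : GL2q q (constM D)
  GL-D = D⁻¹ , λ n → inverse x y (seq (proj₁ s) n) (seq (proj₁ t) n) (proj₂ s n) (proj₂ t n) ,
    inverse (seq (proj₁ s) n) (seq (proj₁ t) n) x y
      (≈-trans (≈-reflexive (ℤ.*-comm _ x)) (proj₂ s n)) (≈-trans (≈-reflexive (ℤ.*-comm _ y)) (proj₂ t n))
  GL-I2 : GL2q q (constM I2)
  GL-I2 = constM I2 , λ n → I2² n , I2² n
    where
    I2² : ∀ n → I2 · I2 ≡M[ pw q n ] I2
    I2² n = ≈M⇒≡M {m = pw q n} (≈M-reflexive (·-identityˡ I2))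
  unit : (D , b) ≡ (D , b) ∘H eH ∘H eH
  unit = sym (trans (cong (_∘H eH) (∘H-identityʳ (D , b))) (∘H-identityʳ (D , b)))

*Mq-inverse : ∀ {q} (s t : Zq q) (X Y : M2q q) n →
  seq s n * seq t n ≈[ pw q n ] 1ℤ → X atM n · Y atM n ≈M[ pw q n ] I2 →
  (s *Mq X) atM n · (t *Mq Y) atM n ≡M[ pw q n ] I2
*Mq-inverse {q} s t X Y n st XY = ≈M⇒≡M {m = pw q n} (*M-inverse {s = seq s n} {t = seq t n} (X atM n) (Y atM n) st XY)

diag-cancel-ℤp : ∀ {p} → Prime p → ∀ l k (T : M2q p) C →
  (∀ N → diag (pw p l) (pw p l * pw p k) · T atM N ≈M[ pw p N ] diag (pw p l) (pw p l * pw p k) · C) →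
  ∀ n → T atM n ≈M[ pw p n ] C
diag-cancel-ℤp {p} pp l k T C h n =
  ≈M-trans (≈M-sym (cohM-+ T n (l ℕ.+ k)))
    (diag-cancel P Q {{pw≢0 pp l}} {{PQ≢0}} (T atM N) C (subst (λ r → A · T atM N ≈M[ r ] A · C) level (h N)))
  where
  P = pw p l
  Q = pw p k
  A = diag P (P * Q)
  N = n ℕ.+ (l ℕ.+ k)
  PQ≢0 : ℤ.NonZero (P * Q)
  PQ≢0 = subst ℤ.NonZero (pw-+ p l k) (pw≢0 pp (l ℕ.+ k))
  level : pw p N ≡ (P * Q) * pw p n
  level = trans (pw-+ʳ p n (l ℕ.+ k)) (cong (_* pw p n) (pw-+ p l k))

pComponent⇒Γ₀-translate : ∀ {p} → Prime p → ∀ l k A → A ≡ diag (pw p l) (pw p l * pw p k) → ∀ a b →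
  InDCq p (A , a) (A , b) →
  Σ (M2q p) λ X → Γ0 p k X × Σ (V2q p) λ w → ∀ n → b ≡V[ pw p n ] (X atM n ⊙ a +v A ⊙ w atV n)
pComponent⇒Γ₀-translate {p} pp l k _ refl a b ((U , u) , (V , v) , (U' , UU') , (V' , VV') , h) =
  detq V *Mq U , (GL-X , y , λ n → ≈⇒≡[] (e21-X n)) , w , λ n → ≈V⇒≡V (proj₂ (decomposition n))
  where
  P = pw p l
  Q = pw p k
  A = diag P (P * Q)
  decomposition : ∀ n → (A · V' atM n ≈M[ pw p n ] U atM n · A) ×
    (b ≈V[ pw p n ] (det (V atM n) *M U atM n) ⊙ a +v A ⊙ (V' atM n ⊙ v atV n +v det (V atM n) *v (adj A ⊙ u atV n)))
  decomposition n = translation-from-double-coset A (U atM n) (V atM n) (V' atM n) (u atV n) (v atV n) a b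
    (≡M⇒≈M (proj₁ (h n))) (≡M⇒≈M (proj₁ (VV' n))) (≡V⇒≈V (proj₂ (h n)))
  GL-X : GL2q p (detq V *Mq U)
  GL-X = detq V' *Mq U' , λ n →
    *Mq-inverse (detq V) (detq V') U U' n
      (det-inverse (V atM n) (V' atM n) (≡M⇒≈M (proj₁ (VV' n)))) (≡M⇒≈M (proj₁ (UU' n))) ,
    *Mq-inverse (detq V') (detq V) U' U n
      (det-inverse (V' atM n) (V atM n) (≡M⇒≈M (proj₂ (VV' n)))) (≡M⇒≈M (proj₂ (UU' n)))
  y : Zq p
  y = detq V *Z shiftZ l (f21 V')
  -- the (2,1) entry of U is read off at the finer level n + l, where cancelling P = p^l leaves p^n
  e21-U : ∀ n → seq (f21 U) (n ℕ.+ l) ≈[ pw p n ] Q * seq (f21 V') (n ℕ.+ l)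
  e21-U n = e21-from-conj P Q {{pw≢0 pp l}} (U atM (n ℕ.+ l)) (V' atM (n ℕ.+ l))
    (subst (λ r → U atM (n ℕ.+ l) · A ≈M[ r ] A · V' atM (n ℕ.+ l)) (pw-+ʳ p n l)
      (≈M-sym (proj₁ (decomposition (n ℕ.+ l)))))
  e21-X : ∀ n → seq (f21 (detq V *Mq U)) n ≈[ pw p n ] Q * seq y n
  e21-X n = ≈-trans (*-congˡ (seq (detq V) n) (≈-trans (≈-sym (coh-+ (f21 U) n l)) (e21-U n)))
    (≈-reflexive (regroup (seq (detq V) n) Q (seq (f21 V') (n ℕ.+ l))))
    where
    regroup : ∀ d Q w → d * (Q * w) ≡ Q * (d * w)
    regroup = solve-∀
  w : V2q p
  w = V' ⊙q v +vq detq V *vq (constM (adj A) ⊙q u)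

Γ₀-translate⇒pComponent : ∀ {p} → Prime p → ∀ l k A → A ≡ diag (pw p l) (pw p l * pw p k) → ∀ a b →
  (Σ (M2q p) λ X → Γ0 p k X × Σ (V2q p) λ w → ∀ n → b ≡V[ pw p n ] (X atM n ⊙ a +v A ⊙ w atV n)) →
  InDCq p (A , a) (A , b)
Γ₀-translate⇒pComponent {p} pp l k _ refl a b (X , ((Y , XY) , y , e21-X) , w , hb) =
  (detq Y *Mq X , constV 0v) , (V , V ⊙q w) , GL-U , GL-V ,
  λ n → ≈M⇒≡M {m = pw p n} (≈M-sym (L.UAV≈A n)) ,
        ≈V⇒≡V {m = pw p n} (L.translation n b a (w atV n) (≡V⇒≈V (hb n)))
  where
  P = pw p l
  Q = pw p k
  module L (n : ℕ) = Untwist {pw p n} P Q (X atM n) (Y atM n) (seq y n)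
    (≡M⇒≈M (proj₁ (XY n))) (≡M⇒≈M (proj₂ (XY n))) (≡[]⇒≈ (e21-X n))
  V₀ : M2q p
  V₀ = record { f11 = f11 Y ; f12 = constZ Q *Z f12 Y ; f21 = -Z (detq Y *Z y) ; f22 = f22 Y }
  W₀ : M2q p
  W₀ = record { f11 = f11 X ; f12 = constZ Q *Z f12 X ; f21 = y ; f22 = f22 X }
  V : M2q p
  V = detq X *Mq V₀
  GL-U : GL2q p (detq Y *Mq X)
  GL-U = detq X *Mq Y , λ n → ≈M⇒≡M {m = pw p n} (L.U·U' n) , ≈M⇒≡M {m = pw p n} (L.U'·U n)
  GL-V : GL2q p V
  GL-V = detq Y *Mq W₀ , λ n →
    ≈M⇒≡M {m = pw p n} (L.V·V' n (diag-cancel-ℤp pp l k (V₀ ·q W₀) I2 L.A·V₀W₀ n)) ,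
    ≈M⇒≡M {m = pw p n} (L.V'·V n (diag-cancel-ℤp pp l k (W₀ ·q V₀) I2 L.A·W₀V₀ n))

InDCGL : M2 → M2 → Set
InDCGL D B = Σ M2 λ U → Σ M2 λ V → GL2ℤ U × GL2ℤ V × (B ≡ U · D · V)

InDCGL-·ʳ : ∀ {D B W} → GL2ℤ W → InDCGL D B → InDCGL D (B · W)
InDCGL-·ʳ {D} {W = W} GL-W (U , V , GL-U , GL-V , refl) =
  U , V · W , GL-U , GL2ℤ-· GL-V GL-W , ·-assoc (U · D) V W

InDCGL-·ˡ : ∀ {D B W} → GL2ℤ W → InDCGL D B → InDCGL D (W · B)
InDCGL-·ˡ {D} {W = W} GL-W (U , V , GL-U , GL-V , refl) =
  W · U , V , GL2ℤ-· GL-W GL-U , GL-V , trans (sym (·-assoc W (U · D) V)) (cong (_· V) (sym (·-assoc W U D)))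

GL2ℤ-lower : ∀ x ε → ε * ε ≡ 1ℤ → GL2ℤ (mat 1ℤ 0ℤ x ε)
GL2ℤ-lower x ε εε = mat 1ℤ 0ℤ (- (ε * x)) ε ,
  mat-≡ refl refl (trans (entry₂₁ x ε) (trans (cong (λ r → x - r * x) εε) (cancel x))) (trans (entry₂₂ x ε) εε) ,
  mat-≡ refl refl (entry₂₁' x ε) (trans (entry₂₂' x ε) εε)
  where
  entry₂₁ : ∀ x ε → x * 1ℤ + ε * (- (ε * x)) ≡ x - (ε * ε) * x
  entry₂₁ = solve-∀
  cancel : ∀ x → x - 1ℤ * x ≡ 0ℤ
  cancel = solve-∀
  entry₂₂ : ∀ x ε → x * 0ℤ + ε * ε ≡ ε * ε
  entry₂₂ = solve-∀
  entry₂₁' : ∀ x ε → (- (ε * x)) * 1ℤ + ε * x ≡ 0ℤ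
  entry₂₁' = solve-∀
  entry₂₂' : ∀ x ε → (- (ε * x)) * 0ℤ + ε * ε ≡ ε * ε
  entry₂₂' = solve-∀

GL2ℤ-Bézout : ∀ a b s t → s * a + t * b ≡ 1ℤ → GL2ℤ (mat a b (- t) s)
GL2ℤ-Bézout a b s t st = mat s (- b) t a ,
  mat-≡ (trans (e₁ a b s t) st) (e₂ a b) (e₃ s t) (trans (e₄ a b s t) st) ,
  mat-≡ (trans (e₅ a b s t) st) (e₆ b s) (e₇ a t) (trans (e₈ a b s t) st)
  where
  e₁ : ∀ a b s t → a * s + b * t ≡ s * a + t * b
  e₁ = solve-∀
  e₂ : ∀ a b → a * (- b) + b * a ≡ 0ℤ
  e₂ = solve-∀
  e₃ : ∀ s t → (- t) * s + s * t ≡ 0ℤ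
  e₃ = solve-∀
  e₄ : ∀ a b s t → (- t) * (- b) + s * a ≡ s * a + t * b
  e₄ = solve-∀
  e₅ : ∀ a b s t → s * a + (- b) * (- t) ≡ s * a + t * b
  e₅ = solve-∀
  e₆ : ∀ b s → s * b + (- b) * s ≡ 0ℤ
  e₆ = solve-∀
  e₇ : ∀ a t → t * a + a * (- t) ≡ 0ℤ
  e₇ = solve-∀
  e₈ : ∀ a b s t → t * b + a * s ≡ s * a + t * b
  e₈ = solve-∀

-- With s a + t b = 1 and x = c s + d t, T = [[1,0],[x,ε]] · diag(1,Q) · [[a,b],[-t,s]].
smith-form : ∀ a b c d ε Q → Coprime ∣ a ∣ ∣ b ∣ → a * d - b * c ≡ ε * Q → ε * ε ≡ 1ℤ →
  InDCGL (diag 1ℤ Q) (mat a b c d)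
smith-form a b c d ε Q cop det≡ εε with ℤ-Bézout a b cop
... | s , t , st = mat 1ℤ 0ℤ x ε , mat a b (- t) s , GL2ℤ-lower x ε εε , GL2ℤ-Bézout a b s t st ,
  mat-≡ (top a (- t) Q) (top b s Q) (sym bottom-left) (sym bottom-right)
  where
  open ≡-Reasoning
  x = c * s + d * t
  top : ∀ a u Q → a ≡ (1ℤ * 1ℤ + 0ℤ * 0ℤ) * a + (1ℤ * 0ℤ + 0ℤ * Q) * u
  top = solve-∀
  bottom-left : (x * 1ℤ + ε * 0ℤ) * a + (x * 0ℤ + ε * Q) * (- t) ≡ c
  bottom-left = begin
    (x * 1ℤ + ε * 0ℤ) * a + (x * 0ℤ + ε * Q) * (- t) ≡⟨ expand c s d t a ε Q ⟩
    (c * s + d * t) * a - (ε * Q) * t                 ≡⟨ cong (λ r → (c * s + d * t) * a - r * t) det≡ ⟨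
    (c * s + d * t) * a - (a * d - b * c) * t         ≡⟨ regroup a b c d s t ⟩
    c * (s * a + t * b)                               ≡⟨ cong (c *_) st ⟩
    c * 1ℤ                                            ≡⟨ ℤ.*-identityʳ c ⟩
    c                                                 ∎
    where
    expand : ∀ c s d t a ε Q → ((c * s + d * t) * 1ℤ + ε * 0ℤ) * a + ((c * s + d * t) * 0ℤ + ε * Q) * (- t)
      ≡ (c * s + d * t) * a - (ε * Q) * t
    expand = solve-∀
    regroup : ∀ a b c d s t → (c * s + d * t) * a - (a * d - b * c) * t ≡ c * (s * a + t * b)
    regroup = solve-∀
  bottom-right : (x * 1ℤ + ε * 0ℤ) * b + (x * 0ℤ + ε * Q) * s ≡ d
  bottom-right = begin
    (x * 1ℤ + ε * 0ℤ) * b + (x * 0ℤ + ε * Q) * s ≡⟨ expand c s d t b ε Q ⟩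
    (c * s + d * t) * b + (ε * Q) * s             ≡⟨ cong (λ r → (c * s + d * t) * b + r * s) det≡ ⟨
    (c * s + d * t) * b + (a * d - b * c) * s     ≡⟨ regroup a b c d s t ⟩
    d * (s * a + t * b)                           ≡⟨ cong (d *_) st ⟩
    d * 1ℤ                                        ≡⟨ ℤ.*-identityʳ d ⟩
    d                                             ∎
    where
    expand : ∀ c s d t b ε Q → ((c * s + d * t) * 1ℤ + ε * 0ℤ) * b + ((c * s + d * t) * 0ℤ + ε * Q) * s
      ≡ (c * s + d * t) * b + (ε * Q) * s
    expand = solve-∀
    regroup : ∀ a b c d s t → (c * s + d * t) * b + (a * d - b * c) * s ≡ d * (s * a + t * b)
    regroup = solve-∀

abs-unit : ∀ ε → ε * ε ≡ 1ℤ → ∣ ε ∣ ≡ 1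
abs-unit ε εε = ℕ.m*n≡1⇒m≡1 ∣ ε ∣ ∣ ε ∣ (trans (sym (ℤ.abs-* ε ε)) (cong ∣_∣ εε))

-- any prime dividing a and b divides det = ε p^k, hence is p, which does not divide a
coprime-row : ∀ {p} → Prime p → ∀ k a b c d ε → ¬ p ℕ.∣ ∣ a ∣ → a * d - b * c ≡ ε * pw p k → ε * ε ≡ 1ℤ →
  Coprime ∣ a ∣ ∣ b ∣
coprime-row {p} pp k a b c d ε p∤a det≡ εε {i} (i∣a , i∣b) = noPrimeDivisor⇒≡1 i i≢0 no-prime
  where
  i≢0 : i ≢ 0
  i≢0 refl = p∤a (subst (p ℕ.∣_) (sym (ℕ.0∣⇒≡0 i∣a)) (p ℕ.∣0))
  no-prime : ∀ r → Prime r → r ℕ.∣ i → ⊥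
  no-prime r pr r∣i =
    p∤a (subst (ℕ._∣ ∣ a ∣) (prime∣prime⇒≡ pr pp (prime∣^⇒∣ pr k r∣p^k)) (ℕ.∣-trans r∣i i∣a))
    where
    r∣det : + r Signed.∣ (a * d - b * c)
    r∣det = Signed.∣m∣n⇒∣m-n (Signed.∣m⇒∣m*n d (Signed.∣ᵤ⇒∣ {i = a} (ℕ.∣-trans r∣i i∣a)))
                             (Signed.∣m⇒∣m*n c (Signed.∣ᵤ⇒∣ {i = b} (ℕ.∣-trans r∣i i∣b)))
    r∣p^k : r ℕ.∣ p ^ k
    r∣p^k = subst (r ℕ.∣_)
      (trans (ℤ.abs-* ε (pw p k)) (trans (cong (ℕ._* (p ^ k)) (abs-unit ε εε)) (ℕ.*-identityˡ (p ^ k))))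
      (Signed.∣⇒∣ᵤ (subst (+ r Signed.∣_) det≡ r∣det))

swap : M2
swap = mat 0ℤ 1ℤ 1ℤ 0ℤ

GL2ℤ-swap : GL2ℤ swap
GL2ℤ-swap = swap , refl , refl

swap-columns : ∀ a b c d → mat b a d c · swap ≡ mat a b c d
swap-columns a b c d = mat-≡ (left b a) (right b a) (left d c) (right d c)
  where
  left : ∀ x y → x * 0ℤ + y * 1ℤ ≡ y
  left = solve-∀
  right : ∀ x y → x * 1ℤ + y * 0ℤ ≡ x
  right = solve-∀

swap-rows : ∀ a b c d → swap · mat c d a b ≡ mat a b c d
swap-rows a b c d = mat-≡ (top c a) (top d b) (bottom c a) (bottom d b)
  where
  top : ∀ x y → 0ℤ * x + 1ℤ * y ≡ y
  top = solve-∀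
  bottom : ∀ x y → 1ℤ * x + 0ℤ * y ≡ x
  bottom = solve-∀

det-negated : ∀ {x y} ε Q → x ≡ ε * Q → y ≡ - x → y ≡ (- ε) * Q
det-negated ε Q x≡ y≡ = trans y≡ (trans (cong -_ x≡) (ℤ.neg-distribˡ-* ε Q))

-ε² : ∀ ε → ε * ε ≡ 1ℤ → (- ε) * (- ε) ≡ 1ℤ
-ε² ε εε = trans (lemma ε) εε
  where
  lemma : ∀ ε → (- ε) * (- ε) ≡ ε * ε
  lemma = solve-∀

det-swap-columns : ∀ a b c d → b * c - a * d ≡ - (a * d - b * c)
det-swap-columns = solve-∀

det-swap-rows : ∀ a b c d → c * b - d * a ≡ - (a * d - b * c)
det-swap-rows = solve-∀

det-rotate : ∀ a b c d → d * a - c * b ≡ a * d - b * c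
det-rotate = solve-∀

smith-form-^ : ∀ {p} → Prime p → ∀ k a b c d ε → a * d - b * c ≡ ε * pw p k → ε * ε ≡ 1ℤ →
  ¬ p ℕ.∣ ∣ a ∣ ⊎ ¬ p ℕ.∣ ∣ b ∣ ⊎ ¬ p ℕ.∣ ∣ c ∣ ⊎ ¬ p ℕ.∣ ∣ d ∣ → InDCGL (diag 1ℤ (pw p k)) (mat a b c d)
smith-form-^ pp k a b c d ε det≡ εε (inj₁ p∤a) =
  smith-form a b c d ε _ (coprime-row pp k a b c d ε p∤a det≡ εε) det≡ εε
smith-form-^ pp k a b c d ε det≡ εε (inj₂ (inj₁ p∤b)) =
  subst (InDCGL _) (swap-columns a b c d) (InDCGL-·ʳ GL2ℤ-swap
    (smith-form-^ pp k b a d c (- ε) (det-negated ε _ det≡ (det-swap-columns a b c d)) (-ε² ε εε) (inj₁ p∤b)))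
smith-form-^ pp k a b c d ε det≡ εε (inj₂ (inj₂ (inj₁ p∤c))) =
  subst (InDCGL _) (swap-rows a b c d) (InDCGL-·ˡ GL2ℤ-swap
    (smith-form-^ pp k c d a b (- ε) (det-negated ε _ det≡ (det-swap-rows a b c d)) (-ε² ε εε) (inj₁ p∤c)))
smith-form-^ pp k a b c d ε det≡ εε (inj₂ (inj₂ (inj₂ p∤d))) =
  subst (InDCGL _) (trans (cong (_· swap) (swap-rows b a d c)) (swap-columns a b c d))
    (InDCGL-·ʳ GL2ℤ-swap (InDCGL-·ˡ GL2ℤ-swap
    (smith-form-^ pp k d c b a ε (trans (det-rotate a b c d) det≡) εε (inj₁ p∤d))))

≈M-multiple : ∀ {P B} M → B ≈M[ P ] P *M M → Σ M2 λ T → B ≡ P *M T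
≈M-multiple {P} {mat _ _ _ _} (mat a b c d) (≈M-by h₁₁ h₁₂ h₂₁ h₂₂) =
  mat (proj₁ (q a h₁₁)) (proj₁ (q b h₁₂)) (proj₁ (q c h₂₁)) (proj₁ (q d h₂₂)) ,
  mat-≡ (proj₂ (q a h₁₁)) (proj₂ (q b h₁₂)) (proj₂ (q c h₂₁)) (proj₂ (q d h₂₂))
  where
  q : ∀ {x} y → x ≈[ P ] P * y → Σ ℤ λ t → x ≡ P * t
  q y h = ≈0⇒∣ (≈-trans h (m*n≈0 y))

module _ {m : ℤ} where

  det-double-coset : ∀ B A U V U' V' → B ≈M[ m ] U · A · V → U · U' ≈M[ m ] I2 → V · V' ≈M[ m ] I2 →
    (det B ≈[ m ] (det U * det V) * det A) × ((det U * det V) * (det U' * det V') ≈[ m ] 1ℤ)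
  det-double-coset B A U V U' V' h hU hV =
    ≈-trans (det-cong h)
      (≈-reflexive (trans (det-· (U · A) V) (trans (cong (_* det V) (det-· U A)) (regroup (det U) (det A) (det V))))) ,
    ≈-trans (≈-reflexive (interchange (det U) (det V) (det U') (det V'))) (*-cong (det-inverse U U' hU) (det-inverse V V' hV))
    where
    regroup : ∀ a b c → a * b * c ≡ (a * c) * b
    regroup = solve-∀
    interchange : ∀ a b c d → (a * b) * (c * d) ≡ (a * c) * (b * d)
    interchange = solve-∀

unit-divisor≡1 : ∀ {m x y} d → x * y ≈[ m ] 1ℤ → d ℕ.∣ ∣ x ∣ → d ℕ.∣ ∣ m ∣ → d ≡ 1
unit-divisor≡1 {m} {x} {y} d (≈-by t e) d∣x d∣m =
  ℕ.∣1⇒≡1 (Signed.∣⇒∣ᵤ (subst (+ d Signed.∣_) (trans (cong (_- t * m) e) (cancel t m)) d∣xy-tm))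
  where
  d∣xy-tm : + d Signed.∣ (x * y - t * m)
  d∣xy-tm = Signed.∣m∣n⇒∣m-n (Signed.∣m⇒∣m*n y (Signed.∣ᵤ⇒∣ {i = x} d∣x))
                             (Signed.∣n⇒∣m*n t (Signed.∣ᵤ⇒∣ {i = m} d∣m))
  cancel : ∀ u v → (1ℤ + u * v) - u * v ≡ 1ℤ
  cancel = solve-∀

unit-mod-prime : ∀ {r} x {y} → Prime r → x * y ≈[ pw r 1 ] 1ℤ → ¬ r ℕ.∣ ∣ x ∣
unit-mod-prime x pr h r∣x = prime≢1 pr (unit-divisor≡1 {x = x} _ h r∣x (ℕ.m∣m*n 1))

q-component⇒¬∣det : ∀ {q} → Prime q → ∀ B b → InDCq q (I2 , 0v) (B , b) → ¬ q ℕ.∣ ∣ det B ∣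
q-component⇒¬∣det {q} pq B b ((U , _) , (V , _) , (U' , UU') , (V' , VV') , h) =
  unit-mod-prime (det B) pq (≈-trans (*-congʳ e (proj₁ dets)) (≈-trans (≈-reflexive (drop-det-I2 f e)) (proj₂ dets)))
  where
  dets = det-double-coset B I2 (U atM 1) (V atM 1) (U' atM 1) (V' atM 1)
    (≡M⇒≈M (proj₁ (h 1))) (≡M⇒≈M (proj₁ (UU' 1))) (≡M⇒≈M (proj₁ (VV' 1)))
  f = det (U atM 1) * det (V atM 1)
  e = det (U' atM 1) * det (V' atM 1)
  drop-det-I2 : ∀ f e → (f * det I2) * e ≡ f * e
  drop-det-I2 = solve-∀

-- At level N = 2l + k + 1, det B = p^(2l) det T against det A = p^(2l+k) forces det T = p^k s,
-- and s agrees modulo p with the unit det U det V.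
p-level-det : ∀ {p} → Prime p → ∀ l k T U V U' V' →
  let N = l ℕ.+ l ℕ.+ (k ℕ.+ 1) in
  pw p l *M T ≈M[ pw p N ] U · diag (pw p l) (pw p l * pw p k) · V →
  U · U' ≈M[ pw p N ] I2 → V · V' ≈M[ pw p N ] I2 →
  Σ ℤ λ s → det T ≡ pw p k * s × ¬ p ℕ.∣ ∣ s ∣
p-level-det {p} pp l k T U V U' V' hB hU hV =
  s , det-T≡ , unit-mod-prime s pp (≈-trans (*-congʳ e s≈f) unit)
  where
  P = pw p l
  Q = pw p k
  p₁ = pw p 1
  A = diag P (P * Q)
  f = det U * det V
  e = det U' * det V'
  instance
    P≢0 : ℤ.NonZero P
    P≢0 = pw≢0 pp l
    Q≢0 : ℤ.NonZero Q
    Q≢0 = pw≢0 pp k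
  P²≢0 : ℤ.NonZero (P * P)
  P²≢0 = ℤ.i*j≢0 P P
  level : pw p (l ℕ.+ l ℕ.+ (k ℕ.+ 1)) ≡ (P * P) * (Q * p₁)
  level = trans (pw-+ p (l ℕ.+ l) (k ℕ.+ 1)) (cong₂ _*_ (pw-+ p l l) (pw-+ p k 1))
  dets = det-double-coset (P *M T) A U V U' V' hB hU hV
  scaled : (P * P) * det T ≈[ (P * P) * (Q * p₁) ] (P * P) * (Q * f)
  scaled = subst (λ r → (P * P) * det T ≈[ r ] (P * P) * (Q * f)) level
    (≈-trans (≈-reflexive (sym (det-*M P T))) (≈-trans (proj₁ dets) (≈-reflexive (regroup f P Q))))
    where
    regroup : ∀ f P Q → f * (P * (P * Q) - 0ℤ * 0ℤ) ≡ (P * P) * (Q * f)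
    regroup = solve-∀
  det-T≈ : det T ≈[ Q * p₁ ] Q * f
  det-T≈ = ≈-cancelˡ (P * P) {{P²≢0}} scaled
  multiple = ≈0⇒∣ (≈-trans (≈-weaken Q p₁ (ℤ.*-comm Q p₁) det-T≈) (m*n≈0 f))
  s = proj₁ multiple
  det-T≡ : det T ≡ Q * s
  det-T≡ = proj₂ multiple
  s≈f : s ≈[ p₁ ] f
  s≈f = ≈-cancelˡ Q (subst (λ r → r ≈[ Q * p₁ ] Q * f) det-T≡ det-T≈)
  unit : f * e ≈[ p₁ ] 1ℤ
  unit = ≈-weaken p₁ ((P * P) * Q) (trans level (sym (ℤ.*-assoc (P * P) Q p₁))) (proj₂ dets)

±1-from-primes : ∀ {p} s → s ≢ 0ℤ → ¬ p ℕ.∣ ∣ s ∣ → (∀ q → Prime q → q ≢ p → ¬ q ℕ.∣ ∣ s ∣) → s * s ≡ 1ℤ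
±1-from-primes {p} s s≢0 p∤s q∤s = square {s} (noPrimeDivisor⇒≡1 ∣ s ∣ (s≢0 ∘ ℤ.∣i∣≡0⇒i≡0) no-prime)
  where
  no-prime : ∀ r → Prime r → r ℕ.∣ ∣ s ∣ → ⊥
  no-prime r pr r∣s with r ℕ.≟ p
  ... | yes refl = p∤s r∣s
  ... | no r≢p = q∤s r pr r≢p r∣s
  square : ∀ {s} → ∣ s ∣ ≡ 1 → s * s ≡ 1ℤ
  square { + .1 } refl = refl
  square { -[1+ 0 ] } refl = refl

1≈0⇒∣m∣≡1 : ∀ {m} → 1ℤ ≈[ m ] 0ℤ → ∣ m ∣ ≡ 1
1≈0⇒∣m∣≡1 {m} (≈-by t e) =
  ℕ.m*n≡1⇒n≡1 ∣ t ∣ ∣ m ∣ (trans (sym (ℤ.abs-* t m)) (cong ∣_∣ (sym (trans e (ℤ.+-identityˡ (t * m))))))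

zeroM : M2
zeroM = mat 0ℤ 0ℤ 0ℤ 0ℤ

·-zeroM-· : ∀ U V → U · zeroM · V ≡ zeroM
·-zeroM-· (mat a b c d) (mat e f g h) = mat-≡ (entry a b e g) (entry a b f h) (entry c d e g) (entry c d f h)
  where
  entry : ∀ a b e g → (a * 0ℤ + b * 0ℤ) * e + (a * 0ℤ + b * 0ℤ) * g ≡ 0ℤ
  entry = solve-∀

-- If p divided every entry, p^l T and hence A would vanish modulo p^(l+1); but A₁₁ = p^l.
some-entry-prime-to-p : ∀ {p} → Prime p → ∀ l k T U V U' V' →
  pw p l *M T ≈M[ pw p (l ℕ.+ 1) ] U · diag (pw p l) (pw p l * pw p k) · V →
  U' · U ≈M[ pw p (l ℕ.+ 1) ] I2 → V · V' ≈M[ pw p (l ℕ.+ 1) ] I2 →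
  ¬ p ℕ.∣ ∣ e11 T ∣ ⊎ ¬ p ℕ.∣ ∣ e12 T ∣ ⊎ ¬ p ℕ.∣ ∣ e21 T ∣ ⊎ ¬ p ℕ.∣ ∣ e22 T ∣
some-entry-prime-to-p {p} pp l k T@(mat t₁₁ t₁₂ t₂₁ t₂₂) U V U' V' hB hU hV
  with p ℕ.∣? ∣ t₁₁ ∣ | p ℕ.∣? ∣ t₁₂ ∣ | p ℕ.∣? ∣ t₂₁ ∣ | p ℕ.∣? ∣ t₂₂ ∣
... | no p∤ | _ | _ | _ = inj₁ p∤
... | yes _ | no p∤ | _ | _ = inj₂ (inj₁ p∤)
... | yes _ | yes _ | no p∤ | _ = inj₂ (inj₂ (inj₁ p∤))
... | yes _ | yes _ | yes _ | no p∤ = inj₂ (inj₂ (inj₂ p∤))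
... | yes d₁₁ | yes d₁₂ | yes d₂₁ | yes d₂₂ =
  ⊥-elim (prime≢1 pp (trans (sym (ℕ.*-identityʳ p)) (1≈0⇒∣m∣≡1 one≈zero)))
  where
  P = pw p l
  p₁ = pw p 1
  A = diag P (P * pw p k)
  level : pw p (l ℕ.+ 1) ≡ p₁ * P
  level = pw-+ʳ p l 1
  vanishes : ∀ t → p ℕ.∣ ∣ t ∣ → P * t ≈[ p₁ * P ] 0ℤ
  vanishes t p∣t with Signed.∣ᵤ⇒∣ {p₁} {t} (subst (ℕ._∣ ∣ t ∣) (sym (ℕ.*-identityʳ p)) p∣t)
  ... | Signed.divides r refl = ≈-by r (lemma P r p₁)
    where
    lemma : ∀ P r p₁ → P * (r * p₁) ≡ 0ℤ + r * (p₁ * P)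
    lemma = solve-∀
  B≈0 : P *M T ≈M[ p₁ * P ] zeroM
  B≈0 = ≈M-by (vanishes t₁₁ d₁₁) (vanishes t₁₂ d₁₂) (vanishes t₂₁ d₂₁) (vanishes t₂₂ d₂₂)
  at-level : ∀ {X Y} → X ≈M[ pw p (l ℕ.+ 1) ] Y → X ≈M[ p₁ * P ] Y
  at-level = subst (λ r → _ ≈M[ r ] _) level
  A≈0 : A ≈M[ p₁ * P ] zeroM
  A≈0 = ≈M-trans (≈M-sym (conj-back (P *M T) A U V U' V' (at-level hB) (at-level hU) (at-level hV)))
          (≈M-trans (·-congʳ V' (·-congˡ U' B≈0)) (≈M-reflexive (·-zeroM-· U' V')))
  one≈zero : 1ℤ ≈[ p₁ ] 0ℤ
  one≈zero = ≈-cancelˡ P {{pw≢0 pp l}}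
    (subst₂ (λ x r → x ≈[ r ] P * 0ℤ) (sym (ℤ.*-identityʳ P)) (ℤ.*-comm p₁ P)
      (≈-trans (≈₁₁ A≈0) (≈-reflexive (sym (ℤ.*-zeroʳ P)))))

InDCGL-*M : ∀ s {D T} → InDCGL D T → InDCGL (s *M D) (s *M T)
InDCGL-*M s {D} (U , V , GL-U , GL-V , refl) = U , V , GL-U , GL-V , sym (·-*M-· s U D V)

∣-abs-*ˡ : ∀ {r} c s → r ℕ.∣ ∣ s ∣ → r ℕ.∣ ∣ c * s ∣
∣-abs-*ˡ c s r∣s = subst (_ ℕ.∣_) (sym (ℤ.abs-* c s)) (ℕ.∣n⇒∣m*n ∣ c ∣ r∣s)

divisible-by-p^l : ∀ {p} l k B U V → B ≈M[ pw p l ] U · diag (pw p l) (pw p l * pw p k) · V →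
  Σ M2 λ T → B ≡ pw p l *M T
divisible-by-p^l {p} l k B U V h = ≈M-multiple (U · diag 1ℤ (pw p k) · V)
  (≈M-trans h (≈M-reflexive (trans (cong (λ D → U · D · V) (diag-factor (pw p l) (pw p k))) (·-*M-· (pw p l) U _ V))))

reduced-InDCGL : ∀ {p} → Prime p → ∀ l k T (U V U' V' : M2q p) →
  (∀ n → pw p l *M T ≈M[ pw p n ] U atM n · diag (pw p l) (pw p l * pw p k) · V atM n) →
  (∀ n → U atM n · U' atM n ≈M[ pw p n ] I2 × U' atM n · U atM n ≈M[ pw p n ] I2) →
  (∀ n → V atM n · V' atM n ≈M[ pw p n ] I2) →
  det T ≢ 0ℤ → (∀ q → Prime q → q ≢ p → ¬ q ℕ.∣ ∣ det T ∣) → InDCGL (diag 1ℤ (pw p k)) T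
reduced-InDCGL {p} pp l k T U V U' V' T≈ UU' VV' det≢0 q∤det =
  from-det (p-level-det pp l k T (U atM N) (V atM N) (U' atM N) (V' atM N) (T≈ N) (proj₁ (UU' N)) (VV' N))
  where
  N = l ℕ.+ l ℕ.+ (k ℕ.+ 1)
  L = l ℕ.+ 1
  from-det : (Σ ℤ λ s → det T ≡ pw p k * s × ¬ p ℕ.∣ ∣ s ∣) → InDCGL (diag 1ℤ (pw p k)) T
  from-det (s , det-T≡ , p∤s) =
    smith-form-^ pp k (e11 T) (e12 T) (e21 T) (e22 T) s (trans det-T≡ (ℤ.*-comm (pw p k) s))
      (±1-from-primes s s≢0 p∤s q∤s)
      (some-entry-prime-to-p pp l k T (U atM L) (V atM L) (U' atM L) (V' atM L) (T≈ L) (proj₂ (UU' L)) (VV' L))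
    where
    s≢0 : s ≢ 0ℤ
    s≢0 s≡0 = det≢0 (trans det-T≡ (trans (cong (pw p k *_) s≡0) (ℤ.*-zeroʳ (pw p k))))
    q∤s : ∀ q → Prime q → q ≢ p → ¬ q ℕ.∣ ∣ s ∣
    q∤s q pq q≢p q∣s = q∤det q pq q≢p (subst (λ x → q ℕ.∣ ∣ x ∣) (sym det-T≡) (∣-abs-*ˡ (pw p k) s q∣s))

adelicDC⇒InDCGL : ∀ {p} → Prime p → ∀ l k A → A ≡ diag (pw p l) (pw p l * pw p k) → ∀ a B b → det B ≢ 0ℤ →
  InAdelicDC p (A , a) (B , b) → InDCGL A B
adelicDC⇒InDCGL {p} pp l k _ refl a B b det≢0 (((U , u) , (V , v) , (U' , UU') , (V' , VV') , h) , away-from-p) =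
  from-multiple (divisible-by-p^l l k B (U atM l) (V atM l) (B≈ l))
  where
  P = pw p l
  B≈ : ∀ n → B ≈M[ pw p n ] U atM n · diag P (P * pw p k) · V atM n
  B≈ n = ≡M⇒≈M (proj₁ (h n))
  from-multiple : (Σ M2 λ T → B ≡ P *M T) → InDCGL (diag P (P * pw p k)) B
  from-multiple (T , B≡) = subst₂ InDCGL (sym (diag-factor P (pw p k))) (sym B≡)
    (InDCGL-*M P (reduced-InDCGL pp l k T U V U' V' (λ n → subst (λ X → X ≈M[ pw p n ] _) B≡ (B≈ n))
      (λ n → ≡M⇒≈M (proj₁ (UU' n)) , ≡M⇒≈M (proj₂ (UU' n))) (λ n → ≡M⇒≈M (proj₁ (VV' n))) det-T≢0 q∤det-T))
    where
    det-B≡ : det B ≡ P * P * det T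
    det-B≡ = trans (cong det B≡) (det-*M P T)
    det-T≢0 : det T ≢ 0ℤ
    det-T≢0 det-T≡0 = det≢0 (trans det-B≡ (trans (cong (P * P *_) det-T≡0) (ℤ.*-zeroʳ (P * P))))
    q∤det-T : ∀ q → Prime q → q ≢ p → ¬ q ℕ.∣ ∣ det T ∣
    q∤det-T q pq q≢p q∣det-T = q-component⇒¬∣det pq B b (away-from-p q pq q≢p)
      (subst (λ x → q ℕ.∣ ∣ x ∣) (sym det-B≡) (∣-abs-*ˡ (P * P) (det T) q∣det-T))

Amat≡diag : ∀ p l k → Amat p l k ≡ diag (pw p l) (pw p l * pw p k)
Amat≡diag p l k = cong (diag (pw p l)) (pw-+ p l k)

lemma4p2 : (p : ℕ) → Prime p → (l k i j : ℕ) → j ≤ l → i ≤ k →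
    let A = Amat p l k
        a = avec p i j
        α = (A , a)
    in
    -- (1)
    ((B : M2) (b : V2) → InΔH (B , b) → InAdelicDC p α (B , b) →
       Σ M2 λ U → Σ M2 λ V → GL2ℤ U × GL2ℤ V × (B ≡ U · A · V))
    ×
    -- (2)
    ((b : V2) → InAdelicDC p α (A , b) ⇔
       (Σ (M2q p) λ X → Γ0 p k X × Σ (V2q p) λ v →
          ∀ n → b ≡V[ pw p n ] ((X atM n) ⊙ a +v A ⊙ (v atV n))))
    ×
    -- (3)
    ((b c : V2) →
       ((x : HZ) → InDCℤ (A , b) x ⇔ InDCℤ (A , c) x) ⇔
       (Σ M2 λ X → GL2ℤ X × (pw p k ∣ e21 X) × Σ V2 λ v →
          b ≡ X ⊙ c +v A ⊙ v))
lemma4p2 p pp l k i j _ _ =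
  adelicDC⇒InDCGL pp l k A A≡ a ,
  (λ b → mk⇔ (pComponent⇒Γ₀-translate pp l k A A≡ a b ∘ proj₁)
             (λ H → Γ₀-translate⇒pComponent pp l k A A≡ a b H ,
                    λ q pq q≢p → q-component P (pw p (l ℕ.+ k)) b
                                   (^-invertible pp pq q≢p l) (^-invertible pp pq q≢p (l ℕ.+ k)))) ,
  (λ b c → mk⇔ (sameDoubleCoset⇒Γ₀-translate P Q A A≡ b c)
               (λ (X , GL-X , Q∣e21 , w , hb) → Γ₀-translate⇒sameDoubleCoset P Q A A≡ b c X GL-X Q∣e21 w hb))
  where
  P = pw p l
  Q = pw p k
  A = Amat p l k
  A≡ = Amat≡diag p l k
  a = avec p i j
  instance
    P≢0 : ℤ.NonZero P
    P≢0 = pw≢0 pp l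
    PQ≢0 : ℤ.NonZero (P * Q)
    PQ≢0 = subst ℤ.NonZero (pw-+ p l k) (pw≢0 pp (l ℕ.+ k))
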